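{- Let ${\cal D}$ be a trivial balanced quadriculated disk and $N$ a positive integer. Then any two tilings ${\mathbf t}_0,{\mathbf t}_1\in{\cal T}({\cal D}\times[0,N])$ satisfy ${\mathbf t}_0\approx{\mathbf t}_1$.
   Context: A quadriculated disk ${\cal D}\subset\mathbb{R}^2$ is a finite union of unit squares $[a,a+1]\times[b,b+1]$, $(a,b)\in\mathbb{Z}^2$, contractible with contractible interior; squares have color $(-1)^{a+b}$ and ${\cal D}$ is balanced if it has equally many squares of each color. ${\cal D}$ is nontrivial if it has at least $6$ unit squares and some square has at least three neighbours (squares of ${\cal D}$ sharing an edge with it); otherwise ${\cal D}$ is trivial. A (3D) domino is the union of two unit cubes with integer vertices sharing a face; a tiling of a union ${\cal R}$ of unit cubes is a set of dominoes with disjoint interiors whose union is ${\cal R}$, and ${\cal T}({\cal R})$ is the set of such tilings. A flip removes two dominoes of a tiling whose union is a $2\times2\times1$ box and replaces them with the other pair of dominoes tiling that box; ${\mathbf t}_0\approx{\mathbf t}_1$ means the tilings are joined by a finite sequence of flips. -}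

module Defs where

open import Data.Nat as ℕ using (ℕ; _%_)
open import Data.Integer as ℤ using (ℤ; ∣_∣; _-_; 0ℤ; 1ℤ)
import Data.Integer.Properties as ℤP
open import Data.Fin using (Fin; zero; suc)
open import Data.Product using (_×_; _,_; ∃; ∃-syntax; Σ)
open import Data.Product.Properties using (≡-dec)
open import Data.Sum using (_⊎_)
open import Data.List using (List; []; _∷_; length; filter; _++_)
open import Data.List.Membership.Propositional using (_∈_; _∉_)
open import Data.List.Relation.Unary.Unique.Propositional using (Unique)
open import Data.List.Relation.Binary.Permutation.Propositional using (_↭_)
open import Relation.Binary.Construct.Closure.ReflexiveTransitive using (Star)
open import Relation.Binary.PropositionalEquality using (_≡_; _≢_)
open import Relation.Nullary using (¬_; yes; no)

-- Planar cells: the unit square [a,a+1]×[b,b+1] is represented by (a , b).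

Cell : Set
Cell = ℤ × ℤ

Adj4 : Cell → Cell → Set
Adj4 (a , b) (a' , b') = ∣ a - a' ∣ ℕ.+ ∣ b - b' ∣ ≡ 1

Connected4 : (Cell → Set) → Set
Connected4 P = ∀ x y → P x → P y →
  Star (λ u v → P u × P v × Adj4 u v) x y

-- Quadriculated disk: union of the listed squares is contractible with
-- contractible interior.  Combinatorial rendering:
-- nonempty, edge-connected, and complement edge-connected.
IsDisk : List Cell → Set
IsDisk D = Unique D × (D ≢ []) × Connected4 (λ x → x ∈ D)
         × Connected4 (λ x → x ∉ D)

-- colour (-1)^(a+b): white = a+b even
count : ∀ {A : Set} → (A → ℕ) → List A → ℕ
count f [] = 0
count f (x ∷ xs) = f x ℕ.+ count f xs

isEven : Cell → ℕ
isEven (a , b) with ∣ a ℤ.+ b ∣ % 2 ℕ.≟ 0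
... | yes _ = 1
... | no _ = 0

isOdd : Cell → ℕ
isOdd (a , b) with ∣ a ℤ.+ b ∣ % 2 ℕ.≟ 0
... | yes _ = 0
... | no _ = 1

Balanced : List Cell → Set
Balanced D = count isEven D ≡ count isOdd D

neighbours : List Cell → Cell → ℕ
neighbours D (a , b) = count f D
  where
  f : Cell → ℕ
  f (a' , b') with ∣ a - a' ∣ ℕ.+ ∣ b - b' ∣ ℕ.≟ 1
  ... | yes _ = 1
  ... | no _ = 0

Nontrivial : List Cell → Set
Nontrivial D = (6 ℕ.≤ length D) × ∃[ x ] (x ∈ D × 3 ℕ.≤ neighbours D x)

Trivial : List Cell → Set
Trivial D = ¬ Nontrivial D

-- Cubes and dominoes in ℝ³: the unit cube with lower corner (a,b,c).

Cube : Set
Cube = ℤ × ℤ × ℤ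

_≟c_ : (x y : Cube) → Relation.Nullary.Dec (x ≡ y)
_≟c_ = ≡-dec ℤ._≟_ (≡-dec ℤ._≟_ ℤ._≟_)

shift : Fin 3 → Cube → Cube
shift zero (a , b , c) = (a ℤ.+ 1ℤ , b , c)
shift (suc zero) (a , b , c) = (a , b ℤ.+ 1ℤ , c)
shift (suc (suc zero)) (a , b , c) = (a , b , c ℤ.+ 1ℤ)

-- the domino (c , i) is the union of the cubes c and c + e_i
-- (each domino has exactly one such representation)
Domino : Set
Domino = Cube × Fin 3

covers : Domino → Cube → ℕ
covers (c , i) x with x ≟c c | x ≟c shift i c
... | yes _ | _ = 1
... | no _ | yes _ = 1
... | no _ | no _ = 0

Region : Set₁
Region = Cube → Set

Prism : List Cell → ℕ → Region
Prism D N (a , b , c) = ((a , b) ∈ D) × (0ℤ ℤ.≤ c) × (c ℤ.< ℤ.+ N)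

IsTiling : Region → List Domino → Set
IsTiling R t = ∀ x → (R x → count (λ d → covers d x) t ≡ 1)
                   × (¬ R x → count (λ d → covers d x) t ≡ 0)

-- a flip: in the 2×2×1 box spanned by c, e_i, e_j (i ≢ j), replace the
-- two dominoes parallel to e_i by the two parallel to e_j.
Flip : List Domino → List Domino → Set
Flip t t' = Σ Cube λ c → Σ (Fin 3) λ i → Σ (Fin 3) λ j → Σ (List Domino) λ rest →
  (i ≢ j) × (t ↭ ((c , i) ∷ (shift j c , i) ∷ rest))
          × (t' ↭ ((c , j) ∷ (shift i c , j) ∷ rest))

-- t ≈ t' : joined by finitely many flips (lists taken up to reordering,
-- since a tiling is a set of dominoes)
_≈_ : List Domino → List Domino → Set
_≈_ = Star (λ s s' → s ↭ s' ⊎ Flip s s')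

-- A cell with three neighbours forces three cells of the opposite colour, hence at least six cells in a
-- balanced disk, so a trivial balanced disk has maximum degree 2. It is then a path, of even length as
-- colours alternate along it, or all its cells have degree 2, and then it is the 2 × 2 square: otherwise
-- the cell diagonally above a corner of minimal a + b is cut off from the rest of the complement, since
-- the parity of the number of vertical edges of the disk crossed by a horizontal ray is constant along
-- the complement.
--
-- In both cases every tiling flips to one without vertical dominoes. Over a path, take the lowest row
-- containing a vertical domino: two consecutive ones enclose a run of horizontal dominoes, and induction
-- on the length of the run either flips them away or finds a shorter such pair one row higher, parity
-- ruling out the remaining case. Over the square, a lowest vertical domino always has a vertical
-- neighbour to flip with; afterwards each level is flipped to east–west dominoes. Each of these normal
-- forms has a single tiling, so any two tilings are joined by flips.

module Submission where

open import Defs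
open import Data.Bool using (Bool; true; false; not)
open import Data.Bool.Properties using (not-involutive; not-¬)
open import Data.Empty using (⊥; ⊥-elim)
open import Data.Fin using (Fin; zero; suc)
import Data.Fin as Fin
open import Data.Integer as ℤ using (ℤ; 0ℤ; 1ℤ; -1ℤ; ∣_∣)
import Data.Integer.Properties as ℤP
open import Algebra.Properties.AbelianGroup ℤP.+-0-abelianGroup using (∙-cancelˡ; ∙-cancelʳ)
open import Data.Integer.Tactic.RingSolver using (solve-∀)
open import Data.List using (List; []; _∷_; length; applyUpTo)
open import Data.List.Extrema ℤP.≤-totalOrder using (argmin; f[argmin]≤f[⊤]; f[argmin]≤f[xs]; argmin-all)
import Data.List.Membership.DecPropositional as DecMembership
open import Data.List.Membership.Propositional using (_∈_; _∉_; find; lose)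
open import Data.List.Membership.Propositional.Properties using (∈-∃++; ∈-applyUpTo⁺; ∈-applyUpTo⁻)
open import Data.List.Membership.Propositional.Properties.WithK using (unique∧set⇒bag)
open import Data.List.Relation.Binary.BagAndSetEquality using (∼bag⇒↭)
open import Data.List.Relation.Binary.Permutation.Propositional
  using (_↭_; ↭-refl; ↭-sym; ↭-trans; prep; swap; ↭⇒↭ₛ)
import Data.List.Relation.Binary.Permutation.Propositional as ↭
open import Data.List.Relation.Binary.Permutation.Propositional.Properties
  using (∈-resp-↭; ↭-length) renaming (shift to ↭-shift)
import Data.List.Relation.Binary.Permutation.Setoid.Properties as ↭ₛ
open import Data.List.Relation.Unary.All using (All; []; _∷_)
import Data.List.Relation.Unary.All as All
open import Data.List.Relation.Unary.AllPairs using ([]; _∷_)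
open import Data.List.Relation.Unary.Any using (Any; here; there; any?)
open import Data.List.Relation.Unary.Unique.Propositional using (Unique)
open import Data.List.Relation.Unary.Unique.Propositional.Properties using (applyUpTo⁺₁; Unique[x∷xs]⇒x∉xs)
open import Data.Nat as ℕ using (ℕ; zero; suc; _+_; _*_; _∸_; _≤_; _<_; z≤n; s≤s; _%_; _<?_)
open import Data.Nat.Induction using (<-rec; <-wellFounded)
import Data.Nat.Properties as ℕP
open import Algebra.Properties.CommutativeSemigroup ℕP.+-commutativeSemigroup using (interchange)
open import Data.Nat.Properties using (anyUpTo?)
open import Data.Nat.Tactic.RingSolver using () renaming (solve-∀ to ℕ-solve-∀)
open import Data.Product using (Σ; ∃; ∃-syntax; _×_; _,_; proj₁; proj₂)
open import Data.Product.Properties using (≡-dec)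
open import Data.Sum using (_⊎_; inj₁; inj₂; [_,_]′)
open import Function using (case_of_; _∘_; _∘′_)
open import Function.Bundles using (_⇔_; Equivalence; mk⇔)
open import Induction.WellFounded using (Acc; acc)
open import Level using (0ℓ)
open import Relation.Binary.Core using (Rel)
open import Relation.Binary.Construct.Closure.ReflexiveTransitive as Star using (Star; ε; _◅_; _◅◅_)
open import Relation.Binary.PropositionalEquality
open import Relation.Binary.PropositionalEquality.Properties using (setoid)
open import Relation.Nullary using (¬_; Dec; yes; no; ¬?)
open import Relation.Nullary.Decidable using (map′; _×-dec_)
open import Relation.Unary using (Pred; Decidable)

private
  variable
    A : Set
    xs ys : List A

𝟙 : ∀ {P : Set} → Dec P → ℕ
𝟙 (yes _) = 1
𝟙 (no _) = 0

𝟙-yes : ∀ {P : Set} (P? : Dec P) → P → 𝟙 P? ≡ 1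
𝟙-yes (yes _) _ = refl
𝟙-yes (no ¬p) p = ⊥-elim (¬p p)

𝟙-no : ∀ {P : Set} (P? : Dec P) → ¬ P → 𝟙 P? ≡ 0
𝟙-no (yes p) ¬p = ⊥-elim (¬p p)
𝟙-no (no _) _ = refl

𝟙-pos : ∀ {P : Set} (P? : Dec P) → 0 < 𝟙 P? → P
𝟙-pos (yes p) _ = p

𝟙-cong : ∀ {P Q : Set} (P? : Dec P) (Q? : Dec Q) → P ⇔ Q → 𝟙 P? ≡ 𝟙 Q?
𝟙-cong (yes p) (yes q) _ = refl
𝟙-cong (yes p) (no ¬q) P⇔Q = ⊥-elim (¬q (Equivalence.to P⇔Q p))
𝟙-cong (no ¬p) (yes q) P⇔Q = ⊥-elim (¬p (Equivalence.from P⇔Q q))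
𝟙-cong (no _) (no _) _ = refl

𝟙-⊎ : ∀ {P Q R : Set} (P? : Dec P) (Q? : Dec Q) (R? : Dec R) → P ⇔ (Q ⊎ R) → ¬ (Q × R) →
      𝟙 P? ≡ 𝟙 Q? + 𝟙 R?
𝟙-⊎ P? (yes q) (yes r) _ disjoint = ⊥-elim (disjoint (q , r))
𝟙-⊎ P? (yes q) (no _) P⇔Q⊎R _ = 𝟙-yes P? (Equivalence.from P⇔Q⊎R (inj₁ q))
𝟙-⊎ P? (no _) (yes r) P⇔Q⊎R _ = 𝟙-yes P? (Equivalence.from P⇔Q⊎R (inj₂ r))
𝟙-⊎ P? (no ¬q) (no ¬r) P⇔Q⊎R _ = 𝟙-no P? ([ ¬q , ¬r ]′ ∘ Equivalence.to P⇔Q⊎R)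

module _ (f : A → ℕ) where

  count-↭ : xs ↭ ys → count f xs ≡ count f ys
  count-↭ ↭.refl = refl
  count-↭ (prep x p) = cong (f x +_) (count-↭ p)
  count-↭ (swap {xs} {ys} x y p) = begin
    f x + (f y + count f xs)  ≡⟨ ℕP.+-assoc (f x) _ _ ⟨
    f x + f y + count f xs    ≡⟨ cong₂ _+_ (ℕP.+-comm (f x) (f y)) (count-↭ p) ⟩
    f y + f x + count f ys    ≡⟨ ℕP.+-assoc (f y) _ _ ⟩
    f y + (f x + count f ys)  ∎
    where open ≡-Reasoning
  count-↭ (↭.trans p q) = trans (count-↭ p) (count-↭ q)

  ∈⇒≤count : ∀ {x} → x ∈ xs → f x ≤ count f xs
  ∈⇒≤count {xs = y ∷ _} (here refl) = ℕP.m≤m+n (f y) _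
  ∈⇒≤count {xs = y ∷ _} (there x∈) = ℕP.≤-trans (∈⇒≤count x∈) (ℕP.m≤n+m _ (f y))

  count>0⇒∃ : ∀ xs → 0 < count f xs → ∃[ x ] x ∈ xs × 0 < f x
  count>0⇒∃ (x ∷ xs) pos with f x in eq
  ... | suc _ = x , here refl , subst (0 <_) (sym eq) (s≤s z≤n)
  ... | zero with count>0⇒∃ xs pos
  ...   | y , y∈ , fy = y , there y∈ , fy

∈⇒↭∷ : ∀ {x} → x ∈ xs → ∃[ ys ] xs ↭ x ∷ ys
∈⇒↭∷ {x = x} x∈ with ∈-∃++ x∈
... | ys , zs , refl = _ , ↭-shift x ys zs

count-cong : (f g : A → ℕ) (xs : List A) → (∀ {x} → x ∈ xs → f x ≡ g x) → count f xs ≡ count g xs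
count-cong f g [] eq = refl
count-cong f g (x ∷ xs) eq = cong₂ _+_ (eq (here refl)) (count-cong f g xs (eq ∘′ there))

count-mono : (f g : A → ℕ) (xs : List A) → (∀ {x} → x ∈ xs → f x ≤ g x) → count f xs ≤ count g xs
count-mono f g [] le = z≤n
count-mono f g (x ∷ xs) le = ℕP.+-mono-≤ (le (here refl)) (count-mono f g xs (λ x∈ → le (there x∈)))

count-+ : (f g : A → ℕ) (xs : List A) → count (λ x → f x + g x) xs ≡ count f xs + count g xs
count-+ f g [] = refl
count-+ f g (x ∷ xs) =
  trans (cong (f x + g x +_) (count-+ f g xs)) (interchange (f x) (g x) (count f xs) (count g xs))

count-0 : (f : A → ℕ) (xs : List A) → (∀ {x} → x ∈ xs → f x ≡ 0) → count f xs ≡ 0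
count-0 f [] _ = refl
count-0 f (x ∷ xs) f≡0 = cong₂ _+_ (f≡0 (here refl)) (count-0 f xs (f≡0 ∘′ there))

count-swap : (h : A → A → ℕ) (xs ys : List A) →
             count (λ x → count (h x) ys) xs ≡ count (λ y → count (λ x → h x y) xs) ys
count-swap h [] ys = sym (count-0 (λ _ → 0) ys λ _ → refl)
count-swap h (x ∷ xs) ys =
  trans (cong (count (h x) ys +_) (count-swap h xs ys)) (sym (count-+ (h x) _ ys))

count-*ˡ : ∀ c (f : A → ℕ) (xs : List A) → count (λ x → c * f x) xs ≡ c * count f xs
count-*ˡ c f [] = sym (ℕP.*-zeroʳ c)
count-*ˡ c f (x ∷ xs) = trans (cong (c * f x +_) (count-*ˡ c f xs)) (sym (ℕP.*-distribˡ-+ c (f x) _))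

count-length : (xs : List A) → count (λ _ → 1) xs ≡ length xs
count-length [] = refl
count-length (_ ∷ xs) = cong suc (count-length xs)

count-⊆ : (f : A → ℕ) → Unique ys → (∀ {y} → y ∈ ys → y ∈ xs) → count f ys ≤ count f xs
count-⊆ {ys = []} f _ _ = z≤n
count-⊆ {ys = y ∷ ys} {xs = xs} f (y∉ys ∷ uniq) ys⊆xs with ∈⇒↭∷ (ys⊆xs (here refl))
... | xs' , xs↭ = begin
  f y + count f ys   ≤⟨ ℕP.+-monoʳ-≤ (f y) (count-⊆ f uniq ys⊆xs') ⟩
  f y + count f xs'  ≡⟨ count-↭ f xs↭ ⟨
  count f xs         ∎
  where
  open ℕP.≤-Reasoning
  ys⊆xs' : ∀ {z} → z ∈ ys → z ∈ xs'
  ys⊆xs' z∈ with ∈-resp-↭ xs↭ (ys⊆xs (there z∈))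
  ... | here refl = ⊥-elim (All.lookup y∉ys z∈ refl)
  ... | there z∈xs' = z∈xs'

count≤1⇒Unique : (w : A → A → ℕ) → (∀ x → 1 ≤ w x x) → (∀ x → count (w x) xs ≤ 1) → Unique xs
count≤1⇒Unique {xs = []} w diag bound = []
count≤1⇒Unique {xs = x ∷ xs} w diag bound = All.tabulate x≢ ∷ count≤1⇒Unique w diag bound'
  where
  bound' : ∀ y → count (w y) xs ≤ 1
  bound' y = ℕP.≤-trans (ℕP.m≤n+m _ (w y x)) (bound y)
  x≢ : ∀ {y} → y ∈ xs → x ≢ y
  x≢ y∈ refl = ℕP.<-irrefl refl (begin-strict
    1                         ≤⟨ diag x ⟩
    w x x                     <⟨ ℕP.m<m+n (w x x) (ℕP.≤-trans (diag x) (∈⇒≤count (w x) y∈)) ⟩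
    w x x + count (w x) xs    ≤⟨ bound x ⟩
    1                         ∎)
    where open ℕP.≤-Reasoning

module _ {A : Set} (_≟_ : (x y : A) → Dec (x ≡ y)) where
  open DecMembership _≟_ using (_∈?_)

  count-≟-unique : ∀ {ws} → Unique ws → ∀ y → count (λ w → 𝟙 (y ≟ w)) ws ≡ 𝟙 (y ∈? ws)
  count-≟-unique {[]} [] y = refl
  count-≟-unique {w ∷ ws} (w∉ws ∷ uniq) y =
    trans (cong (𝟙 (y ≟ w) +_) (count-≟-unique uniq y))
          (sym (𝟙-⊎ (y ∈? (w ∷ ws)) (y ≟ w) (y ∈? ws) (mk⇔ split [ here , there ]′) disjoint))
    where
    split : y ∈ w ∷ ws → y ≡ w ⊎ y ∈ ws
    split (here y≡w) = inj₁ y≡w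
    split (there y∈ws) = inj₂ y∈ws
    disjoint : ¬ (y ≡ w × y ∈ ws)
    disjoint (refl , y∈ws) = All.lookup w∉ws y∈ws refl

Even : ℕ → Set
Even n = n % 2 ≡ 0

Even? : Decidable Even
Even? n = n % 2 ℕ.≟ 0

even⇒¬even-suc : ∀ n → Even n → ¬ Even (suc n)
even⇒¬even-suc (suc (suc n)) = even⇒¬even-suc n

¬even⇒even-suc : ∀ n → ¬ Even n → Even (suc n)
¬even⇒even-suc zero ¬e = ⊥-elim (¬e refl)
¬even⇒even-suc (suc zero) ¬e = refl
¬even⇒even-suc (suc (suc n)) = ¬even⇒even-suc n

¬even-suc⇒even : ∀ n → ¬ Even (suc n) → Even n
¬even-suc⇒even zero _ = refl
¬even-suc⇒even (suc zero) ¬e = ⊥-elim (¬e refl)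
¬even-suc⇒even (suc (suc n)) = ¬even-suc⇒even n

odd⇒suc-even : ∀ n → ¬ Even n → ∃[ m ] n ≡ suc m × Even m
odd⇒suc-even zero ¬e = ⊥-elim (¬e refl)
odd⇒suc-even (suc m) ¬e = m , refl , ¬even-suc⇒even m ¬e

even-+ : ∀ m n → Even m → Even n → Even (m + n)
even-+ zero n _ en = en
even-+ (suc (suc m)) n em en = even-+ m n em en

double-even : ∀ k → Even (k + k)
double-even zero = refl
double-even (suc k) = subst Even (cong suc (sym (ℕP.+-suc k k))) (double-even k)

+-double-parity : ∀ m k → (m + (k + k)) % 2 ≡ m % 2
+-double-parity m zero = cong (_% 2) (ℕP.+-identityʳ m)
+-double-parity m (suc k) = trans (cong (_% 2) shift₂) (+-double-parity m k)
  where
  shift₂ : m + (suc k + suc k) ≡ suc (suc (m + (k + k)))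
  shift₂ = trans (cong (m +_) (cong suc (ℕP.+-suc k k))) (trans (ℕP.+-suc m _) (cong suc (ℕP.+-suc m _)))

suc-parity : ∀ m → suc m % 2 ≢ m % 2
suc-parity zero ()
suc-parity (suc zero) ()
suc-parity (suc (suc m)) = suc-parity m

even-sum⇒same-parity : ∀ m n → Even (m + n) → m % 2 ≡ n % 2
even-sum⇒same-parity zero n e = sym e
even-sum⇒same-parity (suc zero) n e = odd n e
  where
  odd : ∀ n → Even (suc n) → 1 ≡ n % 2
  odd (suc zero) _ = refl
  odd (suc (suc n)) e = odd n e
even-sum⇒same-parity (suc (suc m)) n e = even-sum⇒same-parity m n e

-- With M j meaning that positions j and j + 1 of a row are joined, Covered M k says that position k is
-- joined to one of its neighbours.
Covered : (ℕ → Set) → ℕ → Set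
Covered M k = M k ⊎ ∃[ j ] k ≡ suc j × M j

module Row {M : ℕ → Set} (disjoint : ∀ {k} → M k → ¬ M (suc k)) where

  even-joined : ∀ {n} → (∀ {k} → k < n → Covered M k) → ∀ k → Even k → k < n → M k
  even-joined covered zero _ 0<n with covered 0<n
  ... | inj₁ m0 = m0
  even-joined covered (suc (suc k)) ek k+2<n with covered k+2<n
  ... | inj₁ m = m
  ... | inj₂ (_ , refl , m) = ⊥-elim (disjoint (even-joined covered k ek (ℕP.<-trans (ℕP.m<n+m k (s≤s z≤n)) k+2<n)) m)

  covered⇒even : ∀ n → (∀ {k} → k < n → Covered M k) → (∀ {k} → suc k ≡ n → ¬ M k) → Even n
  covered⇒even n covered open-end with Even? n
  ... | yes en = en
  ... | no ¬en with odd⇒suc-even n ¬en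
  ...   | k , refl , ek = ⊥-elim (open-end refl (even-joined covered k ek (ℕP.n<1+n k)))

module _ {P : Pred ℕ 0ℓ} (P? : Decidable P) where

  First : ℕ → Set
  First m = P m × (∀ {k} → k < m → ¬ P k)

  first : ∀ n → (∀ {k} → k < n → ¬ P k) ⊎ (∃[ m ] m < n × First m)
  first zero = inj₁ λ ()
  first (suc n) with first n
  ... | inj₂ (m , m<n , fm) = inj₂ (m , ℕP.m<n⇒m<1+n m<n , fm)
  ... | inj₁ none with P? n
  ...   | yes p = inj₂ (n , ℕP.n<1+n n , p , none)
  ...   | no ¬p = inj₁ λ k<1+n → case ℕP.m≤n⇒m<n∨m≡n (ℕ.s≤s⁻¹ k<1+n) of λ where
          (inj₁ k<n) → none k<n
          (inj₂ refl) → ¬p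

  first-witness : ∀ {n} → P n → ∃ First
  first-witness {n} p with first (suc n)
  ... | inj₁ none = ⊥-elim (none (ℕP.n<1+n n) p)
  ... | inj₂ (m , _ , fm) = m , fm

module _ {A : Set} (_⟶_ : Rel A 0ℓ) (P : Pred A 0ℓ) (μ : A → ℕ) where

  descend : (∀ {a} → P a → 0 < μ a → ∃[ b ] Star _⟶_ a b × P b × μ b < μ a) →
            ∀ {a} → P a → ∃[ b ] Star _⟶_ a b × P b × μ b ≡ 0
  descend step pa = go (<-wellFounded _) pa
    where
    go : ∀ {a} → Acc _<_ (μ a) → P a → ∃[ b ] Star _⟶_ a b × P b × μ b ≡ 0
    go {a} (acc rec) pa with μ a in eq
    ... | zero = a , ε , pa , eq
    ... | suc _ with step pa (subst (0 <_) (sym eq) (s≤s z≤n))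
    ...   | b , a⟶b , pb , μb<μa with go (rec (subst (μ b <_) eq μb<μa)) pb
    ...     | c , b⟶c , pc , μc≡0 = c , a⟶b ◅◅ b⟶c , pc , μc≡0

pattern east = zero
pattern north = suc zero
pattern up = suc (suc zero)

i≢i+1 : ∀ i → i ≢ i ℤ.+ 1ℤ
i≢i+1 i eq = case ∙-cancelˡ i 0ℤ 1ℤ (trans (ℤP.+-identityʳ i) eq) of λ ()

i≢i+1+1 : ∀ i → i ≢ i ℤ.+ 1ℤ ℤ.+ 1ℤ
i≢i+1+1 i eq =
  case ∙-cancelˡ i 0ℤ (1ℤ ℤ.+ 1ℤ) (trans (ℤP.+-identityʳ i) (trans eq (ℤP.+-assoc i 1ℤ 1ℤ))) of λ ()

shift-comm : ∀ i j c → shift i (shift j c) ≡ shift j (shift i c)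
shift-comm east east c = refl
shift-comm east north c = refl
shift-comm east up c = refl
shift-comm north east c = refl
shift-comm north north c = refl
shift-comm north up c = refl
shift-comm up east c = refl
shift-comm up north c = refl
shift-comm up up c = refl

coordinate-sum : Cube → ℤ
coordinate-sum (a , b , c) = a ℤ.+ b ℤ.+ c

coordinate-sum-shift : ∀ i c → coordinate-sum (shift i c) ≡ coordinate-sum c ℤ.+ 1ℤ
coordinate-sum-shift east (a , b , c) = east-sum a b c
  where
  east-sum : ∀ a b c → a ℤ.+ 1ℤ ℤ.+ b ℤ.+ c ≡ a ℤ.+ b ℤ.+ c ℤ.+ 1ℤ
  east-sum = solve-∀
coordinate-sum-shift north (a , b , c) = north-sum a b c
  where
  north-sum : ∀ a b c → a ℤ.+ (b ℤ.+ 1ℤ) ℤ.+ c ≡ a ℤ.+ b ℤ.+ c ℤ.+ 1ℤ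
  north-sum = solve-∀
coordinate-sum-shift up (a , b , c) = sym (ℤP.+-assoc (a ℤ.+ b) c 1ℤ)

shift≢ : ∀ i c → c ≢ shift i c
shift≢ i c eq = i≢i+1 _ (trans (cong coordinate-sum eq) (coordinate-sum-shift i c))

shift²≢ : ∀ i j c → c ≢ shift i (shift j c)
shift²≢ i j c eq = i≢i+1+1 _ (begin
  coordinate-sum c                           ≡⟨ cong coordinate-sum eq ⟩
  coordinate-sum (shift i (shift j c))       ≡⟨ coordinate-sum-shift i _ ⟩
  coordinate-sum (shift j c) ℤ.+ 1ℤ          ≡⟨ cong (ℤ._+ 1ℤ) (coordinate-sum-shift j c) ⟩
  coordinate-sum c ℤ.+ 1ℤ ℤ.+ 1ℤ             ∎)
  where open ≡-Reasoning

shift-injectiveˡ : ∀ i j c → shift i c ≡ shift j c → i ≡ j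
shift-injectiveˡ east east c eq = refl
shift-injectiveˡ north north c eq = refl
shift-injectiveˡ up up c eq = refl
shift-injectiveˡ east north c eq = ⊥-elim (i≢i+1 _ (sym (cong proj₁ eq)))
shift-injectiveˡ east up c eq = ⊥-elim (i≢i+1 _ (sym (cong proj₁ eq)))
shift-injectiveˡ north east c eq = ⊥-elim (i≢i+1 _ (cong proj₁ eq))
shift-injectiveˡ north up c eq = ⊥-elim (i≢i+1 _ (sym (cong (proj₁ ∘ proj₂) eq)))
shift-injectiveˡ up east c eq = ⊥-elim (i≢i+1 _ (cong proj₁ eq))
shift-injectiveˡ up north c eq = ⊥-elim (i≢i+1 _ (cong (proj₁ ∘ proj₂) eq))

covers-inv : ∀ {c i x} → covers (c , i) x ≡ 1 → x ≡ c ⊎ x ≡ shift i c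
covers-inv {c} {i} {x} _ with x ≟c c | x ≟c shift i c
... | yes x≡c | _ = inj₁ x≡c
... | no _ | yes x≡ic = inj₂ x≡ic

covers-base : ∀ c i → covers (c , i) c ≡ 1
covers-base c i with c ≟c c
... | yes _ = refl
... | no c≢c = ⊥-elim (c≢c refl)

covers-top : ∀ c i → covers (c , i) (shift i c) ≡ 1
covers-top c i with shift i c ≟c c | shift i c ≟c shift i c
... | yes _ | _ = refl
... | no _ | yes _ = refl
... | no _ | no ic≢ic = ⊥-elim (ic≢ic refl)

covers-elsewhere : ∀ {c i x} → x ≢ c → x ≢ shift i c → covers (c , i) x ≡ 0
covers-elsewhere {c} {i} {x} x≢c x≢ic with x ≟c c | x ≟c shift i c
... | yes x≡c | _ = ⊥-elim (x≢c x≡c)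
... | no _ | yes x≡ic = ⊥-elim (x≢ic x≡ic)
... | no _ | no _ = refl

covers-spec : ∀ c i x → covers (c , i) x ≡ 𝟙 (x ≟c c) + 𝟙 (x ≟c shift i c)
covers-spec c i x with x ≟c c | x ≟c shift i c
... | yes refl | yes x≡ix = ⊥-elim (shift≢ i x x≡ix)
... | yes _ | no _ = refl
... | no _ | yes _ = refl
... | no _ | no _ = refl

covers≤1 : ∀ d x → covers d x ≤ 1
covers≤1 (c , i) x with x ≟c c | x ≟c shift i c
... | yes _ | _ = s≤s z≤n
... | no _ | yes _ = s≤s z≤n
... | no _ | no _ = z≤n

Joins : Domino → Cube → Cube → Set
Joins d u v = covers d u ≡ 1 × covers d v ≡ 1

joins : ∀ c i → Joins (c , i) c (shift i c)
joins c i = covers-base c i , covers-top c i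

joins-shift⇒≡ : ∀ {d u i} → Joins d u (shift i u) → d ≡ (u , i)
joins-shift⇒≡ {c , j} {u} {i} (cu , ciu) with covers-inv cu | covers-inv ciu
... | inj₁ refl | inj₁ c≡ic = ⊥-elim (shift≢ i c (sym c≡ic))
... | inj₁ refl | inj₂ ic≡jc = cong (c ,_) (sym (shift-injectiveˡ i j c ic≡jc))
... | inj₂ refl | inj₁ eq = ⊥-elim (shift²≢ i j c (sym eq))
... | inj₂ refl | inj₂ eq = ⊥-elim (shift≢ i _ (sym eq))

joins-injective : ∀ {d d' u v} → u ≢ v → Joins d u v → Joins d' u v → d ≡ d'
joins-injective {c , i} u≢v (cu , cv) j' with covers-inv cu | covers-inv cv
... | inj₁ refl | inj₁ refl = ⊥-elim (u≢v refl)
... | inj₁ refl | inj₂ refl = sym (joins-shift⇒≡ j')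
... | inj₂ refl | inj₁ refl = sym (joins-shift⇒≡ (proj₂ j' , proj₁ j'))
... | inj₂ refl | inj₂ refl = ⊥-elim (u≢v refl)

joins-functional : ∀ {d u v w} → Joins d u v → Joins d u w → u ≢ v → u ≢ w → v ≡ w
joins-functional {c , i} (cu , cv) (_ , cw) u≢v u≢w with covers-inv cu | covers-inv cv | covers-inv cw
... | inj₁ refl | inj₁ refl | _ = ⊥-elim (u≢v refl)
... | inj₁ refl | _ | inj₁ refl = ⊥-elim (u≢w refl)
... | inj₁ refl | inj₂ refl | inj₂ refl = refl
... | inj₂ refl | inj₂ refl | _ = ⊥-elim (u≢v refl)
... | inj₂ refl | _ | inj₂ refl = ⊥-elim (u≢w refl)
... | inj₂ refl | inj₁ refl | inj₁ refl = refl

box-covers : ∀ c i j x →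
  covers (c , i) x + covers (shift j c , i) x ≡ covers (c , j) x + covers (shift i c , j) x
box-covers c i j x
  rewrite covers-spec c i x | covers-spec (shift j c) i x | covers-spec c j x
        | covers-spec (shift i c) j x | shift-comm i j c =
  interchange (𝟙 (x ≟c c)) (𝟙 (x ≟c shift i c)) (𝟙 (x ≟c shift j c)) (𝟙 (x ≟c shift j (shift i c)))

_≟d_ : (d d' : Domino) → Dec (d ≡ d')
_≟d_ = ≡-dec _≟c_ Fin._≟_

↭⇒≈ : ∀ {t t'} → t ↭ t' → t ≈ t'
↭⇒≈ p = inj₁ p ◅ ε

≈-sym : ∀ {t t'} → t ≈ t' → t' ≈ t
≈-sym = Star.reverse step-sym
  where
  step-sym : ∀ {s s'} → s ↭ s' ⊎ Flip s s' → s' ↭ s ⊎ Flip s' s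
  step-sym (inj₁ p) = inj₁ (↭-sym p)
  step-sym (inj₂ (c , i , j , rest , i≢j , p , q)) = inj₂ (c , j , i , rest , i≢j ∘ sym , q , p)

Matched : List Domino → Cube → Cube → Set
Matched t u v = ∃[ d ] d ∈ t × Joins d u v

Matched-sym : ∀ {t u v} → Matched t u v → Matched t v u
Matched-sym (d , d∈ , cu , cv) = d , d∈ , cv , cu

Matched? : ∀ t u v → Dec (Matched t u v)
Matched? t u v = map′ find (λ (d , d∈ , j) → lose d∈ j)
                      (any? (λ d → (covers d u ℕ.≟ 1) ×-dec (covers d v ℕ.≟ 1)) t)

matched-shift⇒∈ : ∀ {t c i} → Matched t c (shift i c) → (c , i) ∈ t
matched-shift⇒∈ {t} (d , d∈ , j) = subst (_∈ t) (joins-shift⇒≡ j) d∈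

∈⇒matched-shift : ∀ {t c i} → (c , i) ∈ t → Matched t c (shift i c)
∈⇒matched-shift {c = c} {i} d∈ = (c , i) , d∈ , joins c i

Matched-frame : ∀ {t d₁ d₂ d₃ d₄ rest u v} → t ↭ d₁ ∷ d₂ ∷ rest →
                covers d₁ u ≡ 0 → covers d₂ u ≡ 0 → Matched t u v → Matched (d₃ ∷ d₄ ∷ rest) u v
Matched-frame p c₁ c₂ (d , d∈ , cu , cv) with ∈-resp-↭ p d∈
... | here refl = case trans (sym c₁) cu of λ ()
... | there (here refl) = case trans (sym c₂) cu of λ ()
... | there (there d∈rest) = d , there (there d∈rest) , cu , cv

module Tiling {R : Region} (R? : Decidable R) where

  private
    variable
      t t' : List Domino
      d d' : Domino
      x u v w : Cube

  coverage≤1 : IsTiling R t → ∀ x → count (λ d → covers d x) t ≤ 1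
  coverage≤1 T x with R? x
  ... | yes r = ℕP.≤-reflexive (proj₁ (T x) r)
  ... | no ¬r = ℕP.≤-trans (ℕP.≤-reflexive (proj₂ (T x) ¬r)) z≤n

  covered : IsTiling R t → R x → ∃[ d ] d ∈ t × covers d x ≡ 1
  covered {t} {x = x} T r with count>0⇒∃ (λ d → covers d x) t (ℕP.≤-reflexive (sym (proj₁ (T x) r)))
  ... | d , d∈ , pos = d , d∈ , ℕP.≤-antisym (covers≤1 d x) pos

  covers⇒∈R : IsTiling R t → d ∈ t → covers d x ≡ 1 → R x
  covers⇒∈R {d = d} {x} T d∈ cx with R? x
  ... | yes r = r
  ... | no ¬r = case ℕP.≤-trans (subst (_≤ _) cx (∈⇒≤count (λ d → covers d x) d∈))
                                (ℕP.≤-reflexive (proj₂ (T x) ¬r)) of λ ()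

  cover-unique : IsTiling R t → d ∈ t → d' ∈ t → covers d x ≡ 1 → covers d' x ≡ 1 → d ≡ d'
  cover-unique {t} {d} {d'} {x} T d∈ d'∈ cx c'x with d ≟d d'
  ... | yes d≡d' = d≡d'
  ... | no d≢d' = case ℕP.≤-trans two≤count (coverage≤1 {t} T x) of λ where (s≤s ())
    where
    two≤count : 2 ≤ count (λ d → covers d x) t
    two≤count = subst₂ (λ m n → m + (n + 0) ≤ count (λ d → covers d x) t) cx c'x
      (count-⊆ (λ d → covers d x) ((d≢d' ∷ []) ∷ [] ∷ []) λ where
        (here refl) → d∈
        (there (here refl)) → d'∈)

  tiling-unique : IsTiling R t → Unique t
  tiling-unique {t} T = count≤1⇒Unique (λ d d' → covers d' (proj₁ d))
                      (λ (c , i) → ℕP.≤-reflexive (sym (covers-base c i)))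
                      (λ (c , _) → coverage≤1 {t} T c)

  partner : IsTiling R t → R u →
            ∃[ i ] (Matched t u (shift i u) ⊎ ∃[ v ] u ≡ shift i v × Matched t u v)
  partner {u = u} T r with covered T r
  ... | (c , i) , d∈ , cu with covers-inv cu
  ...   | inj₁ refl = i , inj₁ ((u , i) , d∈ , joins u i)
  ...   | inj₂ refl = i , inj₂ (c , refl , (c , i) , d∈ , cu , covers-base c i)

  matched⇒∈R : IsTiling R t → Matched t u v → R v
  matched⇒∈R T (d , d∈ , _ , cv) = covers⇒∈R T d∈ cv

  partner-unique : IsTiling R t → Matched t u v → Matched t u w → u ≢ v → u ≢ w → v ≡ w
  partner-unique T (d , d∈ , jv) (d' , d'∈ , jw) u≢v u≢w
    with cover-unique T d∈ d'∈ (proj₁ jv) (proj₁ jw)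
  ... | refl = joins-functional jv jw u≢v u≢w

  private
    flip : ∀ {t c i j} → IsTiling R t → i ≢ j → (c , i) ∈ t → (shift j c , i) ∈ t →
           ∃[ rest ] t ↭ (c , i) ∷ (shift j c , i) ∷ rest
                   × IsTiling R ((c , j) ∷ (shift i c , j) ∷ rest)
                   × t ≈ ((c , j) ∷ (shift i c , j) ∷ rest)
    flip {t} {c} {i} {j} T i≢j ci∈ jci∈ with ∈⇒↭∷ ci∈
    ... | t₁ , t↭ with ∈-resp-↭ t↭ jci∈
    ...   | here eq = ⊥-elim (shift≢ j c (sym (cong proj₁ eq)))
    ...   | there jci∈t₁ with ∈⇒↭∷ jci∈t₁
    ...     | rest , t₁↭ = rest , t↭rest , T' , inj₂ (c , i , j , rest , i≢j , t↭rest , ↭-refl) ◅ ε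
      where
      t↭rest : t ↭ (c , i) ∷ (shift j c , i) ∷ rest
      t↭rest = ↭-trans t↭ (prep (c , i) t₁↭)
      same-coverage : ∀ x → count (λ d → covers d x) t
                          ≡ count (λ d → covers d x) ((c , j) ∷ (shift i c , j) ∷ rest)
      same-coverage x = begin
        count (_at x) t                                    ≡⟨ count-↭ (_at x) t↭rest ⟩
        (c , i) at x + ((shift j c , i) at x + rest# x)    ≡⟨ ℕP.+-assoc ((c , i) at x) _ _ ⟨
        (c , i) at x + (shift j c , i) at x + rest# x      ≡⟨ cong (_+ rest# x) (box-covers c i j x) ⟩
        (c , j) at x + (shift i c , j) at x + rest# x      ≡⟨ ℕP.+-assoc ((c , j) at x) _ _ ⟩
        (c , j) at x + ((shift i c , j) at x + rest# x)    ∎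
        where
        open ≡-Reasoning
        _at_ : Domino → Cube → ℕ
        d at x = covers d x
        rest# : Cube → ℕ
        rest# x = count (_at x) rest
      T' : IsTiling R ((c , j) ∷ (shift i c , j) ∷ rest)
      T' x = (λ r → trans (sym (same-coverage x)) (proj₁ (T x) r))
           , (λ ¬r → trans (sym (same-coverage x)) (proj₂ (T x) ¬r))

  flip-square : ∀ {t c cᵢ cⱼ cᵢⱼ i j} → IsTiling R t → i ≢ j →
                cᵢ ≡ shift i c → cⱼ ≡ shift j c → cᵢⱼ ≡ shift j cᵢ →
                Matched t c cᵢ → Matched t cⱼ cᵢⱼ →
                ∃[ t' ] t ≈ t' × IsTiling R t' × Matched t' c cⱼ × Matched t' cᵢ cᵢⱼ
                      × (∀ {u v} → u ≢ c → u ≢ cᵢ → u ≢ cⱼ → u ≢ cᵢⱼ → Matched t u v → Matched t' u v)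
                      × (∀ w → count w t + (w (c , j) + w (cᵢ , j)) ≡ count w t' + (w (c , i) + w (cⱼ , i)))
  flip-square {t} {c} {i = i} {j} T i≢j refl refl refl c~cᵢ cⱼ~cᵢⱼ
    with flip T i≢j (matched-shift⇒∈ c~cᵢ)
                    (matched-shift⇒∈ (subst (Matched t (shift j c)) (shift-comm j i c) cⱼ~cᵢⱼ))
  ... | rest , t↭ , T' , t≈t' =
    _ , t≈t' , T' , ∈⇒matched-shift (here refl) , ∈⇒matched-shift (there (here refl)) ,
    (λ u≢c u≢cᵢ u≢cⱼ u≢cᵢⱼ → Matched-frame t↭ (covers-elsewhere u≢c u≢cᵢ)
                               (covers-elsewhere u≢cⱼ (subst (_ ≢_) (shift-comm j i c) u≢cᵢⱼ))) ,
    λ w → trans (cong (_+ _) (count-↭ w t↭)) (weights w)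
    where
    weights : ∀ w → w (c , i) + (w (shift j c , i) + count w rest) + (w (c , j) + w (shift i c , j))
                  ≡ w (c , j) + (w (shift i c , j) + count w rest) + (w (c , i) + w (shift j c , i))
    weights w = rearrange (w (c , i)) (w (shift j c , i)) (w (c , j)) (w (shift i c , j)) (count w rest)
      where
      rearrange : ∀ a b c d r → a + (b + r) + (c + d) ≡ c + (d + r) + (a + b)
      rearrange = ℕ-solve-∀

  ⊆⇒↭ : IsTiling R t → IsTiling R t' → (∀ {d} → d ∈ t → d ∈ t') → t ↭ t'
  ⊆⇒↭ {t} {t'} T T' t⊆t' = ∼bag⇒↭ (unique∧set⇒bag (tiling-unique T) (tiling-unique T') (mk⇔ t⊆t' t'⊆t))
    where
    t'⊆t : ∀ {d} → d ∈ t' → d ∈ t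
    t'⊆t {c , i} d∈t' with covered T (covers⇒∈R T' d∈t' (covers-base c i))
    ... | d' , d'∈t , cd' = subst (_∈ t) (cover-unique T' (t⊆t' d'∈t) d∈t' cd' (covers-base c i)) d'∈t

_≟ᶜ_ : (x y : Cell) → Dec (x ≡ y)
_≟ᶜ_ = ≡-dec ℤ._≟_ ℤ._≟_

open DecMembership _≟ᶜ_ using (_∈?_)

shiftᶜ : Fin 2 → Cell → Cell
shiftᶜ zero (a , b) = (a ℤ.+ 1ℤ , b)
shiftᶜ (suc zero) (a , b) = (a , b ℤ.+ 1ℤ)

Adj4? : ∀ x y → Dec (Adj4 x y)
Adj4? (a , b) (a' , b') = ∣ a ℤ.- a' ∣ ℕ.+ ∣ b ℤ.- b' ∣ ℕ.≟ 1

private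
  ∣i-i∣≡0 : ∀ i → ∣ i ℤ.- i ∣ ≡ 0
  ∣i-i∣≡0 i = cong ∣_∣ (ℤP.+-inverseʳ i)

  ∣i-[i+1]∣≡1 : ∀ i → ∣ i ℤ.- (i ℤ.+ 1ℤ) ∣ ≡ 1
  ∣i-[i+1]∣≡1 i = cong ∣_∣ (i-[i+1]≡-1 i)
    where
    i-[i+1]≡-1 : ∀ i → i ℤ.- (i ℤ.+ 1ℤ) ≡ -1ℤ
    i-[i+1]≡-1 = solve-∀

  ∣i-j∣≡∣j-i∣ : ∀ i j → ∣ i ℤ.- j ∣ ≡ ∣ j ℤ.- i ∣
  ∣i-j∣≡∣j-i∣ i j = trans (cong ∣_∣ (i-j≡-[j-i] i j)) (ℤP.∣-i∣≡∣i∣ (j ℤ.- i))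
    where
    i-j≡-[j-i] : ∀ i j → i ℤ.- j ≡ ℤ.- (j ℤ.- i)
    i-j≡-[j-i] = solve-∀

  ∣i-j∣≡0 : ∀ i j → ∣ i ℤ.- j ∣ ≡ 0 → i ≡ j
  ∣i-j∣≡0 i j eq = ℤP.i-j≡0⇒i≡j i j (ℤP.∣i∣≡0⇒i≡0 eq)

  ∣i-j∣≡1 : ∀ i j → ∣ i ℤ.- j ∣ ≡ 1 → i ≡ j ℤ.+ 1ℤ ⊎ j ≡ i ℤ.+ 1ℤ
  ∣i-j∣≡1 i j eq with i ℤ.- j in i-j
  ... | ℤ.+ 1 = inj₁ (trans (i≡[i-j]+j i j) (trans (cong (ℤ._+ j) i-j) (ℤP.+-comm 1ℤ j)))
    where
    i≡[i-j]+j : ∀ i j → i ≡ i ℤ.- j ℤ.+ j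
    i≡[i-j]+j = solve-∀
  ... | ℤ.-[1+ 0 ] = inj₂ (trans (j≡i-[i-j] i j) (cong (λ k → i ℤ.- k) i-j))
    where
    j≡i-[i-j] : ∀ i j → j ≡ i ℤ.- (i ℤ.- j)
    j≡i-[i-j] = solve-∀

Adj4-sym : ∀ {x y} → Adj4 x y → Adj4 y x
Adj4-sym {a , b} {a' , b'} adj = trans (cong₂ _+_ (∣i-j∣≡∣j-i∣ a' a) (∣i-j∣≡∣j-i∣ b' b)) adj

Adj4-irrefl : ∀ x → ¬ Adj4 x x
Adj4-irrefl (a , b) adj = case trans (sym (cong₂ _+_ (∣i-i∣≡0 a) (∣i-i∣≡0 b))) adj of λ ()

Adj4-shiftᶜ : ∀ j x → Adj4 x (shiftᶜ j x)
Adj4-shiftᶜ zero (a , b) = cong₂ _+_ (∣i-[i+1]∣≡1 a) (∣i-i∣≡0 b)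
Adj4-shiftᶜ (suc zero) (a , b) = cong₂ _+_ (∣i-i∣≡0 a) (∣i-[i+1]∣≡1 b)

Adj4⇒shiftᶜ : ∀ {x y} → Adj4 x y → ∃[ j ] (y ≡ shiftᶜ j x ⊎ x ≡ shiftᶜ j y)
Adj4⇒shiftᶜ {a , b} {a' , b'} adj with ∣ a ℤ.- a' ∣ in ∣a-a'∣ | ∣ b ℤ.- b' ∣ in ∣b-b'∣
Adj4⇒shiftᶜ {a , b} {a' , b'} refl | 0 | 1 with ∣i-j∣≡0 a a' ∣a-a'∣ | ∣i-j∣≡1 b b' ∣b-b'∣
... | refl | inj₁ b≡b'+1 = suc zero , inj₂ (cong (a ,_) b≡b'+1)
... | refl | inj₂ b'≡b+1 = suc zero , inj₁ (cong (a ,_) b'≡b+1)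
Adj4⇒shiftᶜ {a , b} {a' , b'} refl | 1 | 0 with ∣i-j∣≡1 a a' ∣a-a'∣ | ∣i-j∣≡0 b b' ∣b-b'∣
... | inj₁ a≡a'+1 | refl = zero , inj₂ (cong (_, b) a≡a'+1)
... | inj₂ a'≡a+1 | refl = zero , inj₁ (cong (_, b) a'≡a+1)

diagonal : Cell → ℤ
diagonal (a , b) = a ℤ.+ b

private
  diagonal-shiftᶜ : ∀ j x → diagonal (shiftᶜ j x) ≡ diagonal x ℤ.+ 1ℤ
  diagonal-shiftᶜ zero (a , b) = east-sum a b
    where
    east-sum : ∀ a b → a ℤ.+ 1ℤ ℤ.+ b ≡ a ℤ.+ b ℤ.+ 1ℤ
    east-sum = solve-∀
  diagonal-shiftᶜ (suc zero) (a , b) = sym (ℤP.+-assoc a b 1ℤ)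

  ∣i+1∣ : ∀ i → ∣ i ℤ.+ 1ℤ ∣ ≡ suc ∣ i ∣ ⊎ suc ∣ i ℤ.+ 1ℤ ∣ ≡ ∣ i ∣
  ∣i+1∣ (ℤ.+ n) = inj₁ (ℕP.+-comm n 1)
  ∣i+1∣ ℤ.-[1+ zero ] = inj₂ refl
  ∣i+1∣ ℤ.-[1+ suc n ] = inj₂ refl

  even-suc⇔odd : ∀ n → Even (suc n) ⇔ (¬ Even n)
  even-suc⇔odd n = mk⇔ (λ e-sn e-n → even⇒¬even-suc n e-n e-sn) (¬even⇒even-suc n)

  even-∣i+1∣⇔odd-∣i∣ : ∀ i → Even ∣ i ℤ.+ 1ℤ ∣ ⇔ (¬ Even ∣ i ∣)
  even-∣i+1∣⇔odd-∣i∣ i with ∣i+1∣ i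
  ... | inj₁ eq rewrite eq = even-suc⇔odd ∣ i ∣
  ... | inj₂ eq rewrite sym eq = mk⇔ (even⇒¬even-suc ∣ i ℤ.+ 1ℤ ∣) (¬even-suc⇒even ∣ i ℤ.+ 1ℤ ∣)

  isEven≡𝟙 : ∀ x → isEven x ≡ 𝟙 (Even? ∣ diagonal x ∣)
  isEven≡𝟙 (a , b) with ∣ a ℤ.+ b ∣ ℕ.% 2 ℕ.≟ 0
  ... | yes _ = refl
  ... | no _ = refl

  isOdd≡𝟙 : ∀ x → isOdd x ≡ 𝟙 (¬? (Even? ∣ diagonal x ∣))
  isOdd≡𝟙 (a , b) with ∣ a ℤ.+ b ∣ ℕ.% 2 ℕ.≟ 0
  ... | yes _ = refl
  ... | no _ = refl

isEven+isOdd : ∀ x → isEven x + isOdd x ≡ 1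
isEven+isOdd (a , b) with ∣ a ℤ.+ b ∣ ℕ.% 2 ℕ.≟ 0
... | yes _ = refl
... | no _ = refl

isEven-shiftᶜ : ∀ j x → isEven (shiftᶜ j x) ≡ isOdd x
isEven-shiftᶜ j x = begin
  isEven (shiftᶜ j x)                    ≡⟨ isEven≡𝟙 (shiftᶜ j x) ⟩
  𝟙 (Even? ∣ diagonal (shiftᶜ j x) ∣)    ≡⟨ cong (𝟙 ∘ Even? ∘ ∣_∣) (diagonal-shiftᶜ j x) ⟩
  𝟙 (Even? ∣ diagonal x ℤ.+ 1ℤ ∣)        ≡⟨ 𝟙-cong _ _ (even-∣i+1∣⇔odd-∣i∣ (diagonal x)) ⟩
  𝟙 (¬? (Even? ∣ diagonal x ∣))          ≡⟨ isOdd≡𝟙 x ⟨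
  isOdd x                                ∎
  where open ≡-Reasoning

isEven-Adj4 : ∀ {x y} → Adj4 x y → isEven y ≡ isOdd x
isEven-Adj4 {x} {y} adj with Adj4⇒shiftᶜ {x} {y} adj
... | j , inj₁ refl = isEven-shiftᶜ j x
... | j , inj₂ refl = ℕP.+-cancelˡ-≡ (isEven (shiftᶜ j y)) _ _ (begin
  isEven (shiftᶜ j y) + isEven y         ≡⟨ cong (_+ isEven y) (isEven-shiftᶜ j y) ⟩
  isOdd y + isEven y                     ≡⟨ ℕP.+-comm (isOdd y) _ ⟩
  isEven y + isOdd y                     ≡⟨ isEven+isOdd y ⟩
  1                                      ≡⟨ isEven+isOdd (shiftᶜ j y) ⟨
  isEven (shiftᶜ j y) + isOdd (shiftᶜ j y) ∎)
  where open ≡-Reasoning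

adjacency : Cell → Cell → ℕ
adjacency x y = 𝟙 (Adj4? x y)

neighbours≡count : ∀ D x → neighbours D x ≡ count (adjacency x) D
neighbours≡count [] (a , b) = refl
neighbours≡count ((a' , b') ∷ D) (a , b) with ∣ a ℤ.- a' ∣ ℕ.+ ∣ b ℤ.- b' ∣ ℕ.≟ 1
... | yes _ = cong suc (neighbours≡count D (a , b))
... | no _ = neighbours≡count D (a , b)

private
  adjacency≤isEven : ∀ x y → isOdd x ≡ 1 → adjacency x y ≤ isEven y
  adjacency≤isEven x y odd with Adj4? x y
  ... | yes adj = ℕP.≤-reflexive (sym (trans (isEven-Adj4 {x} {y} adj) odd))
  ... | no _ = z≤n

  adjacency≤isOdd : ∀ x y → isEven x ≡ 1 → adjacency x y ≤ isOdd y
  adjacency≤isOdd x y even with Adj4? x y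
  ... | yes adj = ℕP.≤-reflexive (trans (sym even) (isEven-Adj4 {y} {x} (Adj4-sym {x} {y} adj)))
  ... | no _ = z≤n

  colour-count≤2 : ∀ {D} → Balanced D → length D < 6 → count isEven D ≤ 2
  colour-count≤2 {D} bal len<6 = ℕP.≮⇒≥ λ 2<h → ℕP.<-irrefl refl (begin-strict
    6                              ≤⟨ ℕP.+-mono-≤ 2<h 2<h ⟩
    count isEven D + count isEven D ≡⟨ cong (count isEven D +_) bal ⟩
    count isEven D + count isOdd D  ≡⟨ count-+ isEven isOdd D ⟨
    count (λ y → isEven y + isOdd y) D ≡⟨ count-cong (λ y → isEven y + isOdd y) (λ _ → 1) D (λ {y} _ → isEven+isOdd y) ⟩
    count (λ _ → 1) D              ≡⟨ count-length D ⟩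
    length D                       <⟨ len<6 ⟩
    6                              ∎)
    where open ℕP.≤-Reasoning

trivial⇒degree≤2 : ∀ {D} → Balanced D → Trivial D → ∀ {x} → x ∈ D → count (adjacency x) D ≤ 2
trivial⇒degree≤2 {D} bal triv {x} x∈ with 6 ℕP.≤? length D
... | yes 6≤len = ℕP.≤-pred (ℕP.≰⇒> λ 3≤deg →
                    triv (6≤len , x , x∈ , subst (3 ≤_) (sym (neighbours≡count D x)) 3≤deg))
... | no 6≰len with isEven x in even | isOdd x in odd | isEven+isOdd x
...   | 1 | 0 | _ = ℕP.≤-trans (count-mono (adjacency x) isOdd D λ {y} _ → adjacency≤isOdd x y even)
                      (subst (_≤ 2) bal (colour-count≤2 {D} bal (ℕP.≰⇒> 6≰len)))
...   | 0 | 1 | _ = ℕP.≤-trans (count-mono (adjacency x) isEven D λ {y} _ → adjacency≤isEven x y odd)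
                      (colour-count≤2 {D} bal (ℕP.≰⇒> 6≰len))

adjacency-yes : ∀ {x y} → Adj4 x y → adjacency x y ≡ 1
adjacency-yes {x} {y} = 𝟙-yes (Adj4? x y)

length≤degree : ∀ {D x ys} → Unique ys → (∀ {y} → y ∈ ys → y ∈ D × Adj4 x y) →
                length ys ≤ count (adjacency x) D
length≤degree {D} {x} {ys} uniq ys⊆nbrs = begin
  length ys                  ≡⟨ count-length ys ⟨
  count (λ _ → 1) ys         ≡⟨ count-cong _ (adjacency x) ys (λ {y} y∈ → sym (adjacency-yes {x} {y} (proj₂ (ys⊆nbrs y∈)))) ⟩
  count (adjacency x) ys     ≤⟨ count-⊆ (adjacency x) uniq (proj₁ ∘ ys⊆nbrs) ⟩
  count (adjacency x) D      ∎
  where open ℕP.≤-Reasoning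

leaf-neighbour : ∀ {D x v} → count (adjacency x) D ≤ 1 → v ∈ D → Adj4 x v → ∀ {u} → u ∈ D → Adj4 x u → u ≡ v
leaf-neighbour {D} {x} {v} leaf v∈ x~v {u} u∈ x~u with u ≟ᶜ v
... | yes u≡v = u≡v
... | no u≢v = case ℕP.≤-trans (length≤degree {D} {x} ((u≢v ∷ []) ∷ [] ∷ []) u,v-adjacent) leaf of λ where (s≤s ())
  where
  u,v-adjacent : ∀ {w} → w ∈ u ∷ v ∷ [] → w ∈ D × Adj4 x w
  u,v-adjacent (here refl) = u∈ , x~u
  u,v-adjacent (there (here refl)) = v∈ , x~v

-- Paths

record Path (D : List Cell) : Set where
  field
    len : ℕ
    cell : ℕ → Cell
    cell∈ : ∀ {k} → k < len → cell k ∈ D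
    cell-surjective : ∀ {x} → x ∈ D → ∃[ k ] k < len × cell k ≡ x
    cell-injective : ∀ {i j} → i < len → j < len → cell i ≡ cell j → i ≡ j
    adjacent : ∀ {k} → suc k < len → Adj4 (cell k) (cell (suc k))
    adjacent⇒consecutive : ∀ {i j} → i < len → j < len → Adj4 (cell i) (cell j) → j ≡ suc i ⊎ i ≡ suc j

module _ {D : List Cell} (P : Path D) where
  open Path P

  cells : List Cell
  cells = applyUpTo cell len

  D↭cells : Unique D → D ↭ cells
  D↭cells uniq = ∼bag⇒↭ (unique∧set⇒bag uniq unique-cells (mk⇔ to from))
    where
    unique-cells : Unique cells
    unique-cells = applyUpTo⁺₁ cell len λ i<j j<len eq →
      ℕP.<-irrefl (cell-injective (ℕP.<-trans i<j j<len) j<len eq) i<j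
    to : ∀ {x} → x ∈ D → x ∈ cells
    to x∈ with cell-surjective x∈
    ... | k , k<len , refl = ∈-applyUpTo⁺ cell k<len
    from : ∀ {x} → x ∈ cells → x ∈ D
    from x∈ with ∈-applyUpTo⁻ cell x∈
    ... | k , k<len , refl = cell∈ k<len

private
  alternating⇒even : ∀ n (h : ℕ → Cell) → (∀ {k} → suc k < n → isEven (h (suc k)) ≡ isOdd (h k)) →
                     count isEven (applyUpTo h n) ≡ count isOdd (applyUpTo h n) → Even n
  alternating⇒even zero h alt balanced = refl
  alternating⇒even (suc zero) h alt balanced with isEven (h 0) | isOdd (h 0) | isEven+isOdd (h 0)
  ... | 0 | 1 | _ = case balanced of λ ()
  ... | 1 | 0 | _ = case balanced of λ ()
  alternating⇒even (suc (suc n)) h alt balanced =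
    alternating⇒even n (λ k → h (suc (suc k))) (alt ∘ s≤s ∘ s≤s) (cancel (isEven (h 0)) (isOdd (h 0)) (begin
      isEven (h 0) + (isOdd (h 0) + count isEven rest)   ≡⟨ cong (λ e → isEven (h 0) + (e + count isEven rest)) e₁≡o₀ ⟨
      count isEven (applyUpTo h (suc (suc n)))           ≡⟨ balanced ⟩
      isOdd (h 0) + (isOdd (h 1) + count isOdd rest)     ≡⟨ cong (λ o → isOdd (h 0) + (o + count isOdd rest)) o₁≡e₀ ⟩
      isOdd (h 0) + (isEven (h 0) + count isOdd rest)    ∎))
    where
    open ≡-Reasoning
    rest = applyUpTo (λ k → h (suc (suc k))) n
    e₁≡o₀ : isEven (h 1) ≡ isOdd (h 0)
    e₁≡o₀ = alt (s≤s (s≤s z≤n))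
    o₁≡e₀ : isOdd (h 1) ≡ isEven (h 0)
    o₁≡e₀ = ℕP.+-cancelˡ-≡ (isEven (h 1)) _ _ (begin
      isEven (h 1) + isOdd (h 1)   ≡⟨ isEven+isOdd (h 1) ⟩
      1                            ≡⟨ isEven+isOdd (h 0) ⟨
      isEven (h 0) + isOdd (h 0)   ≡⟨ ℕP.+-comm (isEven (h 0)) _ ⟩
      isOdd (h 0) + isEven (h 0)   ≡⟨ cong (_+ isEven (h 0)) e₁≡o₀ ⟨
      isEven (h 1) + isEven (h 0)  ∎)
    cancel : ∀ a b {x y} → a + (b + x) ≡ b + (a + y) → x ≡ y
    cancel a b {x} {y} eq = ℕP.+-cancelˡ-≡ (a + b) x y (begin
      a + b + x    ≡⟨ ℕP.+-assoc a b x ⟩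
      a + (b + x)  ≡⟨ eq ⟩
      b + (a + y)  ≡⟨ ℕP.+-assoc b a y ⟨
      b + a + y    ≡⟨ cong (_+ y) (ℕP.+-comm b a) ⟩
      a + b + y    ∎)

path-even : ∀ {D} → Unique D → Balanced D → (P : Path D) → Even (Path.len P)
path-even {D} uniq bal P = alternating⇒even len cell alternate (begin
  count isEven (cells P)  ≡⟨ count-↭ isEven (D↭cells P uniq) ⟨
  count isEven D          ≡⟨ bal ⟩
  count isOdd D           ≡⟨ count-↭ isOdd (D↭cells P uniq) ⟩
  count isOdd (cells P)   ∎)
  where
  open Path P
  open ≡-Reasoning
  alternate : ∀ {k} → suc k < len → isEven (cell (suc k)) ≡ isOdd (cell k)
  alternate {k} k+1<len = isEven-Adj4 {cell k} {cell (suc k)} (adjacent k+1<len)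

private
  Edge : List Cell → Cell → Cell → Set
  Edge D u v = u ∈ D × v ∈ D × Adj4 u v

  singleton-path : ∀ {D x₀} → D ↭ x₀ ∷ [] → x₀ ∈ D → Σ (Path D) λ P → Path.cell P 0 ≡ x₀
  singleton-path {x₀ = x₀} D↭ x₀∈ = record
    { len = 1
    ; cell = λ _ → x₀
    ; cell∈ = λ _ → x₀∈
    ; cell-surjective = λ x∈ → case ∈-resp-↭ D↭ x∈ of λ where
        (here refl) → 0 , s≤s z≤n , refl
    ; cell-injective = λ where (s≤s z≤n) (s≤s z≤n) _ → refl
    ; adjacent = λ where (s≤s ())
    ; adjacent⇒consecutive = λ where (s≤s z≤n) (s≤s z≤n) adj → ⊥-elim (Adj4-irrefl x₀ adj)
    } , refl

  module Removal {D D' : List Cell} {x₀ q : Cell} (D↭ : D ↭ x₀ ∷ D') (x₀∉D' : x₀ ∉ D')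
                 (q∈D : q ∈ D) (x₀~q : Adj4 x₀ q) (neighbour : ∀ {u} → u ∈ D → Adj4 x₀ u → u ≡ q) where

    D'⊆D : ∀ {u} → u ∈ D' → u ∈ D
    D'⊆D u∈ = ∈-resp-↭ (↭-sym D↭) (there u∈)

    split : ∀ {u} → u ∈ D → u ≡ x₀ ⊎ u ∈ D'
    split u∈ with ∈-resp-↭ D↭ u∈
    ... | here u≡x₀ = inj₁ u≡x₀
    ... | there u∈D' = inj₂ u∈D'

    q∈D' : q ∈ D'
    q∈D' with split q∈D
    ... | inj₁ refl = ⊥-elim (Adj4-irrefl x₀ x₀~q)
    ... | inj₂ q∈' = q∈'

    lift : ∀ {u v} → Star (Edge D) u v → v ∈ D' →
           (u ∈ D' → Star (Edge D') u v) × (u ≡ x₀ → Star (Edge D') q v)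
    lift ε v∈ = (λ _ → ε) , λ where refl → ⊥-elim (x₀∉D' v∈)
    lift {u} ((u∈ , w∈ , adj) ◅ walk) v∈ with lift walk v∈ | split w∈
    ... | _ , from-x₀ | inj₁ refl =
          (λ _ → subst (λ u → Star (Edge D') u _) (sym (neighbour u∈ (Adj4-sym {u} {x₀} adj))) (from-x₀ refl))
        , λ where refl → ⊥-elim (Adj4-irrefl x₀ adj)
    ... | from-w , _ | inj₂ w∈' =
          (λ u∈' → (u∈' , w∈' , adj) ◅ from-w w∈')
        , λ where refl → subst (λ u → Star (Edge D') u _) (neighbour w∈ adj) (from-w w∈')

    connected : Connected4 (_∈ D) → Connected4 (_∈ D')
    connected conn x y x∈ y∈ = proj₁ (lift (conn x y (D'⊆D x∈) (D'⊆D y∈)) y∈) x∈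

    degree-split : ∀ x → count (adjacency x) D ≡ adjacency x x₀ + count (adjacency x) D'
    degree-split x = count-↭ (adjacency x) D↭

    remaining-degree≤2 : (∀ {x} → x ∈ D → count (adjacency x) D ≤ 2) → ∀ {x} → x ∈ D' → count (adjacency x) D' ≤ 2
    remaining-degree≤2 deg {x} x∈ = ℕP.≤-trans (ℕP.m≤n+m _ (adjacency x x₀)) (subst (_≤ 2) (degree-split x) (deg (D'⊆D x∈)))

    q-leaf : (∀ {x} → x ∈ D → count (adjacency x) D ≤ 2) → count (adjacency q) D' ≤ 1
    q-leaf deg = ℕP.≤-pred (subst (_≤ 2) (trans (degree-split q) (cong (_+ _) (adjacency-yes {q} {x₀} (Adj4-sym {x₀} {q} x₀~q))))
                                  (deg q∈D))

    prepend : (P : Path D') → Path.cell P 0 ≡ q → Σ (Path D) λ P⁺ → Path.cell P⁺ 0 ≡ x₀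
    prepend P cell0≡q = record
      { len = suc len
      ; cell = cell⁺
      ; cell∈ = cell⁺∈
      ; cell-surjective = λ x∈ → case split x∈ of λ where
          (inj₁ refl) → 0 , s≤s z≤n , refl
          (inj₂ x∈') → let k , k<len , eq = cell-surjective x∈' in suc k , s≤s k<len , eq
      ; cell-injective = injective
      ; adjacent = adjacent⁺
      ; adjacent⇒consecutive = consecutive
      } , refl
      where
      open Path P
      0<len : 0 < len
      0<len = ℕP.≤-trans (s≤s z≤n) (proj₁ (proj₂ (cell-surjective q∈D')))
      cell⁺ : ℕ → Cell
      cell⁺ zero = x₀
      cell⁺ (suc k) = cell k
      cell⁺∈ : ∀ {k} → k < suc len → cell⁺ k ∈ D
      cell⁺∈ {zero} _ = ∈-resp-↭ (↭-sym D↭) (here refl)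
      cell⁺∈ {suc k} (s≤s k<len) = D'⊆D (cell∈ k<len)
      adjacent⁺ : ∀ {k} → suc k < suc len → Adj4 (cell⁺ k) (cell⁺ (suc k))
      adjacent⁺ {zero} _ = subst (Adj4 x₀) (sym cell0≡q) x₀~q
      adjacent⁺ {suc k} (s≤s k+1<len) = adjacent k+1<len
      x₀≢cell : ∀ {k} → k < len → x₀ ≢ cell k
      x₀≢cell k<len eq = x₀∉D' (subst (_∈ D') (sym eq) (cell∈ k<len))
      injective : ∀ {i j} → i < suc len → j < suc len → cell⁺ i ≡ cell⁺ j → i ≡ j
      injective {zero} {zero} _ _ _ = refl
      injective {zero} {suc j} _ (s≤s j<len) eq = ⊥-elim (x₀≢cell j<len eq)
      injective {suc i} {zero} (s≤s i<len) _ eq = ⊥-elim (x₀≢cell i<len (sym eq))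
      injective {suc i} {suc j} (s≤s i<len) (s≤s j<len) eq = cong suc (cell-injective i<len j<len eq)
      only-0 : ∀ {j} → j < len → Adj4 x₀ (cell j) → j ≡ 0
      only-0 j<len adj = cell-injective j<len 0<len (trans (neighbour (D'⊆D (cell∈ j<len)) adj) (sym cell0≡q))
      consecutive : ∀ {i j} → i < suc len → j < suc len → Adj4 (cell⁺ i) (cell⁺ j) → j ≡ suc i ⊎ i ≡ suc j
      consecutive {zero} {zero} _ _ adj = ⊥-elim (Adj4-irrefl x₀ adj)
      consecutive {zero} {suc j} _ (s≤s j<len) adj = inj₁ (cong suc (only-0 j<len adj))
      consecutive {suc i} {zero} (s≤s i<len) _ adj = inj₂ (cong suc (only-0 i<len (Adj4-sym {cell i} {x₀} adj)))
      consecutive {suc i} {suc j} (s≤s i<len) (s≤s j<len) adj =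
        [ inj₁ ∘ cong suc , inj₂ ∘ cong suc ]′ (adjacent⇒consecutive i<len j<len adj)

path-from-leaf : ∀ {D} → Unique D → Connected4 (_∈ D) → (∀ {x} → x ∈ D → count (adjacency x) D ≤ 2) →
                 ∀ {x₀} → x₀ ∈ D → count (adjacency x₀) D ≤ 1 → Path D
path-from-leaf {D} uniq conn deg x₀∈ leaf = proj₁ (build (length D) refl uniq conn deg x₀∈ leaf)
  where
  build : ∀ n {D} → length D ≡ n → Unique D → Connected4 (_∈ D) →
          (∀ {x} → x ∈ D → count (adjacency x) D ≤ 2) →
          ∀ {x₀} → x₀ ∈ D → count (adjacency x₀) D ≤ 1 → Σ (Path D) λ P → Path.cell P 0 ≡ x₀
  build n {D} len≡n uniq conn deg {x₀} x₀∈ leaf with ∈⇒↭∷ x₀∈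
  ... | [] , D↭ = singleton-path D↭ x₀∈
  ... | y ∷ ys , D↭ with ↭ₛ.Unique-resp-↭ (setoid Cell) (↭⇒↭ₛ D↭) uniq | n
  ...   | _ | zero = case trans (sym len≡n) (↭-length D↭) of λ ()
  ...   | uniq₀@(_ ∷ uniq') | suc n' with conn x₀ y x₀∈ (∈-resp-↭ (↭-sym D↭) (there (here refl)))
  ...     | ε = ⊥-elim (Unique[x∷xs]⇒x∉xs uniq₀ (here refl))
  ...     | _◅_ {j = q} (_ , q∈ , x₀~q) _ = prepend (proj₁ rest) (proj₂ rest)
    where
    open Removal D↭ (Unique[x∷xs]⇒x∉xs uniq₀) q∈ x₀~q (leaf-neighbour {D} {x₀} leaf q∈ x₀~q)
    rest = build n' (ℕP.suc-injective (trans (sym (↭-length D↭)) len≡n)) uniq' (connected conn) (remaining-degree≤2 deg)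
                 q∈D' (q-leaf deg)

cube : Cell → ℕ → Cube
cube (a , b) z = (a , b , ℤ.+ z)

cube-injective : ∀ {x y z z'} → cube x z ≡ cube y z' → x ≡ y × z ≡ z'
cube-injective refl = refl , refl

cube≢ˣ : ∀ {x y z z'} → x ≢ y → cube x z ≢ cube y z'
cube≢ˣ x≢y = x≢y ∘ proj₁ ∘ cube-injective

cube≢ᶻ : ∀ {x y z z'} → z ≢ z' → cube x z ≢ cube y z'
cube≢ᶻ z≢z' = z≢z' ∘ proj₂ ∘ cube-injective

cube-up : ∀ x z → cube x (suc z) ≡ shift up (cube x z)
cube-up (a , b) z = cong (λ n → (a , b , ℤ.+ n)) (ℕP.+-comm 1 z)

planar : Fin 2 → Fin 3
planar = Fin.inject₁

planar≢up : ∀ j → planar j ≢ up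
planar≢up zero ()
planar≢up (suc zero) ()

cube-shiftᶜ : ∀ j x z → cube (shiftᶜ j x) z ≡ shift (planar j) (cube x z)
cube-shiftᶜ zero (a , b) z = refl
cube-shiftᶜ (suc zero) (a , b) z = refl

isVertical : Domino → ℕ
isVertical (_ , up) = 1
isVertical (_ , east) = 0
isVertical (_ , north) = 0

isVertical-planar : ∀ c j → isVertical (c , planar j) ≡ 0
isVertical-planar c zero = refl
isVertical-planar c (suc zero) = refl

shifted-cube : ∀ i {x y z z'} → cube y z' ≡ shift i (cube x z) →
               (y ≡ x × z' ≡ suc z) ⊎ (z' ≡ z × ∃[ j ] y ≡ shiftᶜ j x)
shifted-cube east {x} {z = z} eq with cube-injective (trans eq (sym (cube-shiftᶜ zero x z)))
... | refl , refl = inj₂ (refl , zero , refl)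
shifted-cube north {x} {z = z} eq with cube-injective (trans eq (sym (cube-shiftᶜ (suc zero) x z)))
... | refl , refl = inj₂ (refl , suc zero , refl)
shifted-cube up {x} {z = z} eq with cube-injective (trans eq (sym (cube-up x z)))
... | refl , refl = inj₁ (refl , refl)

module PrismTiling (D : List Cell) (N : ℕ) where

  Prism? : Decidable (Prism D N)
  Prism? (a , b , c) = ((a , b) ∈? D) ×-dec ((0ℤ ℤP.≤? c) ×-dec (c ℤP.<? ℤ.+ N))

  open Tiling Prism? public

  cube∈ : ∀ {x z} → x ∈ D → z < N → Prism D N (cube x z)
  cube∈ {a , b} x∈ z<N = x∈ , ℤ.+≤+ z≤n , ℤ.+<+ z<N

  ∈⇒cube : ∀ {c} → Prism D N c → ∃[ x ] ∃[ z ] c ≡ cube x z × x ∈ D × z < N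
  ∈⇒cube {a , b , ℤ.+ z} (x∈ , _ , z<N) = (a , b) , z , refl , x∈ , ℤP.drop‿+<+ z<N

  Up : List Domino → Cell → ℕ → Set
  Up t x z = Matched t (cube x z) (cube x (suc z))

  Level : List Domino → Cell → Cell → ℕ → Set
  Level t x y z = Matched t (cube x z) (cube y z)

  Frame : Cell → Cell → List Domino → List Domino → Set
  Frame x y t t' = ∀ {w z v} → w ≢ x → w ≢ y → Matched t (cube w z) v → Matched t' (cube w z) v

  classify : ∀ {t x z} → IsTiling (Prism D N) t → x ∈ D → z < N →
             Up t x z ⊎ (∃[ z' ] z ≡ suc z' × Up t x z') ⊎ (∃[ y ] y ∈ D × Adj4 x y × Level t x y z)
  classify {t} {x} {z} T x∈ z<N with partner T (cube∈ x∈ z<N)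
  ... | i , inj₁ x~ with ∈⇒cube (matched⇒∈R T x~)
  ...   | y , z' , eq , y∈ , _ with shifted-cube i (sym eq)
  ...     | inj₁ (refl , refl) = inj₁ (subst (Matched t (cube x z)) eq x~)
  ...     | inj₂ (refl , j , refl) = inj₂ (inj₂ (y , y∈ , Adj4-shiftᶜ j x , subst (Matched t (cube x z)) eq x~))
  classify {t} {x} {z} T x∈ z<N | i , inj₂ (v , eq , x~v) with ∈⇒cube (matched⇒∈R T x~v)
  ...   | y , z' , refl , y∈ , _ with shifted-cube i eq
  ...     | inj₁ (refl , refl) = inj₂ (inj₁ (z' , refl , Matched-sym x~v))
  ...     | inj₂ (refl , j , refl) = inj₂ (inj₂ (y , y∈ , Adj4-sym {y} {x} (Adj4-shiftᶜ j y) , x~v))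

  private
    Frame-sym : ∀ {x y t t'} → Frame x y t t' → Frame y x t t'
    Frame-sym frame w≢y w≢x = frame w≢x w≢y

    flip-vertical′ : ∀ {t x z} j → IsTiling (Prism D N) t → Up t x z → Up t (shiftᶜ j x) z →
                     ∃[ t' ] t ≈ t' × IsTiling (Prism D N) t'
                           × Level t' x (shiftᶜ j x) z × Level t' x (shiftᶜ j x) (suc z)
                           × count isVertical t ≡ 2 + count isVertical t' × Frame x (shiftᶜ j x) t t'
    flip-vertical′ {t} {x} {z} j T x↑ y↑
      with flip-square T (planar≢up j ∘ sym) (cube-up x z) (cube-shiftᶜ j x z) (cube-shiftᶜ j x (suc z)) x↑ y↑
    ... | t' , t≈t' , T' , x~y , x~y⁺ , frame , weights =
      t' , t≈t' , T' , x~y , x~y⁺ , vertical-count ,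
      λ w≢x w≢y → frame (cube≢ˣ w≢x) (cube≢ˣ w≢x) (cube≢ˣ w≢y) (cube≢ˣ w≢y)
      where
      vertical-count : count isVertical t ≡ 2 + count isVertical t'
      vertical-count = begin
        count isVertical t                                     ≡⟨ ℕP.+-identityʳ _ ⟨
        count isVertical t + 0                                 ≡⟨ cong (count isVertical t +_) (cong₂ _+_
                                                                    (isVertical-planar (cube x z) j)
                                                                    (isVertical-planar (cube x (suc z)) j)) ⟨
        count isVertical t + (isVertical (cube x z , planar j) + isVertical (cube x (suc z) , planar j))
                                                               ≡⟨ weights isVertical ⟩
        count isVertical t' + 2                                ≡⟨ ℕP.+-comm _ 2 ⟩
        2 + count isVertical t'                                ∎
        where open ≡-Reasoning

    flip-horizontal′ : ∀ {t x z} j → IsTiling (Prism D N) t →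
                       Level t x (shiftᶜ j x) z → Level t x (shiftᶜ j x) (suc z) →
                       ∃[ t' ] t ≈ t' × IsTiling (Prism D N) t' × Up t' x z × Up t' (shiftᶜ j x) z
                             × count isVertical t' ≡ 2 + count isVertical t × Frame x (shiftᶜ j x) t t'
    flip-horizontal′ {t} {x} {z} j T x~y x~y⁺
      with flip-square T (planar≢up j) (cube-shiftᶜ j x z) (cube-up x z) (cube-up (shiftᶜ j x) z) x~y x~y⁺
    ... | t' , t≈t' , T' , x↑ , y↑ , frame , weights =
      t' , t≈t' , T' , x↑ , y↑ , vertical-count ,
      λ w≢x w≢y → frame (cube≢ˣ w≢x) (cube≢ˣ w≢y) (cube≢ˣ w≢x) (cube≢ˣ w≢y)
      where
      vertical-count : count isVertical t' ≡ 2 + count isVertical t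
      vertical-count = begin
        count isVertical t'                                    ≡⟨ ℕP.+-identityʳ _ ⟨
        count isVertical t' + 0                                ≡⟨ cong (count isVertical t' +_) (cong₂ _+_
                                                                    (isVertical-planar (cube x z) j)
                                                                    (isVertical-planar (cube x (suc z)) j)) ⟨
        count isVertical t' + (isVertical (cube x z , planar j) + isVertical (cube x (suc z) , planar j))
                                                               ≡⟨ weights isVertical ⟨
        count isVertical t + 2                                 ≡⟨ ℕP.+-comm _ 2 ⟩
        2 + count isVertical t                                 ∎
        where open ≡-Reasoning

  flip-vertical : ∀ {t x y z} → IsTiling (Prism D N) t → Adj4 x y → Up t x z → Up t y z →
                  ∃[ t' ] t ≈ t' × IsTiling (Prism D N) t' × Level t' x y z × Level t' x y (suc z)
                        × count isVertical t ≡ 2 + count isVertical t' × Frame x y t t'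
  flip-vertical {x = x} {y} T x~y x↑ y↑ with Adj4⇒shiftᶜ {x} {y} x~y
  ... | j , inj₁ refl = flip-vertical′ j T x↑ y↑
  ... | j , inj₂ refl with flip-vertical′ j T y↑ x↑
  ...   | t' , t≈t' , T' , y~x , y~x⁺ , count-eq , frame =
          t' , t≈t' , T' , Matched-sym y~x , Matched-sym y~x⁺ , count-eq , Frame-sym frame

  flip-horizontal : ∀ {t x y z} → IsTiling (Prism D N) t → Adj4 x y → Level t x y z → Level t x y (suc z) →
                    ∃[ t' ] t ≈ t' × IsTiling (Prism D N) t' × Up t' x z × Up t' y z
                          × count isVertical t' ≡ 2 + count isVertical t × Frame x y t t'
  flip-horizontal {x = x} {y} T x~y x~y₀ x~y₁ with Adj4⇒shiftᶜ {x} {y} x~y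
  ... | j , inj₁ refl = flip-horizontal′ j T x~y₀ x~y₁
  ... | j , inj₂ refl with flip-horizontal′ j T (Matched-sym x~y₀) (Matched-sym x~y₁)
  ...   | t' , t≈t' , T' , y↑ , x↑ , count-eq , frame = t' , t≈t' , T' , x↑ , y↑ , count-eq , Frame-sym frame

  Reducible : List Domino → Set
  Reducible t = ∃[ t' ] t ≈ t' × IsTiling (Prism D N) t' × count isVertical t' < count isVertical t

  Up⇒<N : ∀ {t x z} → IsTiling (Prism D N) t → Up t x z → suc z < N
  Up⇒<N T x↑ with ∈⇒cube (matched⇒∈R T x↑)
  ... | _ , _ , eq , _ , z+1< = subst (_< N) (sym (proj₂ (cube-injective eq))) z+1<

  vertical-pair⇒reducible : ∀ {t x y z} → IsTiling (Prism D N) t → Adj4 x y → Up t x z → Up t y z → Reducible t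
  vertical-pair⇒reducible {t} T x~y x↑ y↑ with flip-vertical T x~y x↑ y↑
  ... | t' , t≈t' , T' , _ , _ , count-eq , _ =
    t' , t≈t' , T' , subst (count isVertical t' <_) (sym count-eq) (ℕP.m<n+m _ (s≤s z≤n))

  Up? : ∀ t x z → Dec (Up t x z)
  Up? t x z = Matched? t (cube x z) (cube x (suc z))

  vertical-domino : ∀ {t} → IsTiling (Prism D N) t → 0 < count isVertical t → ∃[ x ] ∃[ z ] x ∈ D × Up t x z
  vertical-domino {t} T pos with count>0⇒∃ isVertical t pos
  ... | (c , east) , _ , ()
  ... | (c , north) , _ , ()
  ... | (c , up) , d∈ , _ with ∈⇒cube (covers⇒∈R T d∈ (covers-base c up))
  ...   | x , z , refl , x∈ , _ = x , z , x∈ , subst (Matched t (cube x z)) (sym (cube-up x z)) (∈⇒matched-shift d∈)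

  remove-verticals : (∀ {t} → IsTiling (Prism D N) t → 0 < count isVertical t → Reducible t) →
                     ∀ {t} → IsTiling (Prism D N) t → ∃[ t' ] t ≈ t' × IsTiling (Prism D N) t' × count isVertical t' ≡ 0
  remove-verticals = descend _ (IsTiling (Prism D N)) (count isVertical)

  Up⇒count>0 : ∀ {t x z} → Up t x z → 0 < count isVertical t
  Up⇒count>0 {t} {x} {z} x↑ =
    ∈⇒≤count isVertical (matched-shift⇒∈ (subst (Matched t (cube x z)) (cube-up x z) x↑))

  same-partner : ∀ {t x y y' z z₁ z₂} → IsTiling (Prism D N) t →
                 Matched t (cube x z) (cube y z₁) → Matched t (cube x z) (cube y' z₂) →
                 cube x z ≢ cube y z₁ → cube x z ≢ cube y' z₂ → y ≡ y' × z₁ ≡ z₂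
  same-partner T x~y x~y' ne ne' = cube-injective (partner-unique T x~y x~y' ne ne')

-- Prisms over paths

module PathPrism {D : List Cell} (P : Path D) (N : ℕ) where
  open Path P
  open PrismTiling D N

  ⟦_,_⟧ : ℕ → ℕ → Cube
  ⟦ k , z ⟧ = cube (cell k) z

  Vert : List Domino → ℕ → ℕ → Set
  Vert t k z = k < len × Up t (cell k) z

  Horiz : List Domino → ℕ → ℕ → Set
  Horiz t k z = suc k < len × Level t (cell k) (cell (suc k)) z

  Flat : List Domino → ℕ → ℕ → Set
  Flat t k z = Covered (λ j → Horiz t j z) k

  Vert? : ∀ t k z → Dec (Vert t k z)
  Vert? t k z = (k <? len) ×-dec Matched? t _ _

  private
    variable
      t t' : List Domino
      k a z : ℕ

    <len : suc k < len → k < len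
    <len = ℕP.<-trans (ℕP.n<1+n _)

    ⟦⟧-injective : ∀ {k k' z z'} → k < len → k' < len → ⟦ k , z ⟧ ≡ ⟦ k' , z' ⟧ → (k , z) ≡ (k' , z')
    ⟦⟧-injective k< k'< eq with cube-injective eq
    ... | cells≡ , refl = cong (_, _) (cell-injective k< k'< cells≡)

    one-partner : IsTiling (Prism D N) t → ∀ {k₁ z₁ k₂ z₂} → k < len → k₁ < len → k₂ < len →
                  Matched t ⟦ k , z ⟧ ⟦ k₁ , z₁ ⟧ → Matched t ⟦ k , z ⟧ ⟦ k₂ , z₂ ⟧ →
                  (k , z) ≢ (k₁ , z₁) → (k , z) ≢ (k₂ , z₂) → (k₁ , z₁) ≡ (k₂ , z₂)
    one-partner T k< k₁< k₂< m₁ m₂ ne₁ ne₂ with same-partner T m₁ m₂ (ne₁ ∘ ⟦⟧-injective k< k₁<) (ne₂ ∘ ⟦⟧-injective k< k₂<)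
    ... | cells≡ , refl = cong (_, _) (cell-injective k₁< k₂< cells≡)

    n≢1+n : ∀ {n} → n ≢ suc n
    n≢1+n {n} = ℕP.<⇒≢ (ℕP.n<1+n n)

    k≢1+k : ∀ {k z z' : ℕ} → (k , z) ≢ (suc k , z')
    k≢1+k eq = n≢1+n (cong proj₁ eq)

    z≢1+z : ∀ {k z : ℕ} → (k , z) ≢ (k , suc z)
    z≢1+z eq = n≢1+n (cong proj₂ eq)

  vert-flat : IsTiling (Prism D N) t → Vert t k z → ¬ Flat t k z
  vert-flat T (k< , k↑) (inj₁ (k+1< , k~k+1)) =
    k≢1+k (one-partner T k< k< k+1< k↑ k~k+1 z≢1+z k≢1+k)
  vert-flat T (k< , k↑) (inj₂ (j , refl , (_ , j~k))) =
    k≢1+k (one-partner T k< (<len k<) k< (Matched-sym j~k) k↑ (k≢1+k ∘ sym) z≢1+z)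

  vert-flat-above : IsTiling (Prism D N) t → Vert t k z → ¬ Flat t k (suc z)
  vert-flat-above T (k< , k↑) (inj₁ (k+1< , k~k+1)) =
    k≢1+k (one-partner T k< k< k+1< (Matched-sym k↑) k~k+1 (z≢1+z ∘ sym) k≢1+k)
  vert-flat-above T (k< , k↑) (inj₂ (j , refl , (_ , j~k))) =
    k≢1+k (one-partner T k< (<len k<) k< (Matched-sym j~k) (Matched-sym k↑) (k≢1+k ∘ sym) (z≢1+z ∘ sym))

  horiz-disjoint : IsTiling (Prism D N) t → Horiz t k z → ¬ Horiz t (suc k) z
  horiz-disjoint T (k+1< , k~k+1) (k+2< , k+1~k+2) =
    k≢2+k (cong proj₁ (one-partner T k+1< (<len k+1<) k+2< (Matched-sym k~k+1) k+1~k+2 (k≢1+k ∘ sym) k≢1+k))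
    where
    k≢2+k : ∀ {k} → k ≢ suc (suc k)
    k≢2+k {k} = ℕP.<⇒≢ (ℕP.m<n+m k (s≤s z≤n))

  classify-pos : IsTiling (Prism D N) t → k < len → z < N →
                 Vert t k z ⊎ (∃[ z' ] z ≡ suc z' × Vert t k z') ⊎ Flat t k z
  classify-pos {k = k} T k< z< with classify T (cell∈ k<) z<
  ... | inj₁ k↑ = inj₁ (k< , k↑)
  ... | inj₂ (inj₁ (z' , refl , k↑)) = inj₂ (inj₁ (z' , refl , k< , k↑))
  ... | inj₂ (inj₂ (y , y∈ , k~y , level)) with cell-surjective y∈
  ...   | m , m< , refl with adjacent⇒consecutive k< m< k~y
  ...     | inj₁ refl = inj₂ (inj₂ (inj₁ (m< , level)))
  ...     | inj₂ refl = inj₂ (inj₂ (inj₂ (m , refl , k< , Matched-sym level)))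

  private
    cell≢ : ∀ {k a} → k < len → a < len → k ≢ a → cell k ≢ cell a
    cell≢ k< a< k≢a = k≢a ∘ cell-injective k< a<

    frame-vert : Frame (cell a) (cell (suc a)) t t' → suc a < len → k ≢ a → k ≢ suc a → Vert t k z → Vert t' k z
    frame-vert frame a+1< k≢a k≢a+1 (k< , k↑) =
      k< , frame (cell≢ k< (<len a+1<) k≢a) (cell≢ k< a+1< k≢a+1) k↑

    frame-flat : Frame (cell a) (cell (suc a)) t t' → suc a < len → k < len → k ≢ a → k ≢ suc a →
                 Flat t k z → Flat t' k z
    frame-flat frame a+1< k< k≢a k≢a+1 (inj₁ (k+1< , k~k+1)) =
      inj₁ (k+1< , frame (cell≢ k< (<len a+1<) k≢a) (cell≢ k< a+1< k≢a+1) k~k+1)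
    frame-flat frame a+1< k< k≢a k≢a+1 (inj₂ (j , refl , (_ , j~k))) =
      inj₂ (j , refl , k< , Matched-sym (frame (cell≢ k< (<len a+1<) k≢a) (cell≢ k< a+1< k≢a+1) (Matched-sym j~k)))

    top<N : IsTiling (Prism D N) t → Vert t k z → suc z < N
    top<N T (_ , k↑) = Up⇒<N T k↑

    vertical-pair : IsTiling (Prism D N) t → Vert t a z → Vert t (suc a) z → Reducible t
    vertical-pair T (_ , a↑) (a+1< , a+1↑) = vertical-pair⇒reducible T (adjacent a+1<) a↑ a+1↑

    segment-even : IsTiling (Prism D N) t → ∀ s n →
                   (∀ {j} → j < n → Flat t (j + s) z) → (∀ {i} → suc i ≡ s → ¬ Horiz t i z) →
                   (∀ {j} → suc j ≡ n → ¬ Horiz t (j + s) z) → Even n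
    segment-even {t} {z} T s n flats left right = Row.covered⇒even (horiz-disjoint T) n row-covered right
      where
      row-covered : ∀ {j} → j < n → Covered (λ j → Horiz t (j + s) z) j
      row-covered {j} j<n with flats j<n
      ... | inj₁ h = inj₁ h
      row-covered {zero} j<n | inj₂ (i , s≡1+i , h) = ⊥-elim (left (sym s≡1+i) h)
      row-covered {suc j} j<n | inj₂ (i , refl , h) = inj₂ (j , refl , h)

    beyond : ∀ {p} a → suc (suc a) < p → p ≢ a × p ≢ suc a × p ≢ suc (suc a)
    beyond a a+2<p = (λ where refl → ℕP.<-asym a+2<p (ℕP.<-trans (ℕP.n<1+n _) (ℕP.n<1+n _)))
                   , (λ where refl → ℕP.<-asym a+2<p (ℕP.n<1+n _))
                   , (λ where refl → ℕP.<-irrefl refl a+2<p)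

    Gap : ℕ → Set
    Gap n = ∀ {t a z} → IsTiling (Prism D N) t → Vert t a z → Vert t (n + suc a) z →
            (∀ {j} → j < n → Flat t (j + suc a) z) → Reducible t

    -- The cube right of a is horizontal. Either so is the cube above it, and two flips move the left
    -- vertical domino two steps right, or a vertical domino starts above it, and the first vertical
    -- domino after it in row z + 1 gives a shorter gap, which exists by parity.
    module WideGap (n : ℕ) (rec : ∀ {m} → m < suc (suc n) → Gap m) {t a z} (T : IsTiling (Prism D N) t)
                (a↑ : Vert t a z) (b↑ : Vert t (suc (suc (n + suc a))) z)
                (flats : ∀ {j} → j < suc (suc n) → Flat t (j + suc a) z) where

      a+1~a+2 : Horiz t (suc a) z
      a+1~a+2 with flats {0} (s≤s z≤n)
      ... | inj₁ h = h
      ... | inj₂ (_ , refl , a~a+1) = ⊥-elim (vert-flat T a↑ (inj₁ a~a+1))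

      a+2< : suc (suc a) < len
      a+2< = proj₁ a+1~a+2

      b-far : ∀ m → suc (suc a) < suc (suc (m + suc a))
      b-far m = s≤s (s≤s (ℕP.m≤n+m (suc a) m))

      shift₂ : ∀ j → j + suc (suc (suc a)) ≡ suc (suc (j + suc a))
      shift₂ j = trans (ℕP.+-suc j _) (cong suc (ℕP.+-suc j _))

      b< : suc (suc (n + suc a)) < len
      b< = proj₁ b↑

      a≢a+1 : a ≢ suc a
      a≢a+1 = ℕP.<⇒≢ (ℕP.n<1+n a)

      a≢a+2 : a ≢ suc (suc a)
      a≢a+2 = ℕP.<⇒≢ (ℕP.<-trans (ℕP.n<1+n a) (ℕP.n<1+n (suc a)))

      flip-branch : Horiz t (suc a) (suc z) → Reducible t
      flip-branch a+1~a+2⁺ with flip-horizontal T (adjacent a+2<) (proj₂ a+1~a+2) (proj₂ a+1~a+2⁺)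
      ... | t₁ , t≈t₁ , T₁ , a+1↑₁ , a+2↑₁ , count₁ , frame₁
          with flip-vertical T₁ (adjacent (<len a+2<)) (proj₂ (frame-vert frame₁ a+2< a≢a+1 a≢a+2 a↑)) a+1↑₁
      ...   | t₂ , t₁≈t₂ , T₂ , _ , _ , count₂ , frame₂ =
              via (t≈t₁ ◅◅ t₁≈t₂) (rec (ℕP.m<n+m n (s≤s z≤n)) T₂ a+2↑₂ b↑₂ flats₂)
        where
        via : t ≈ t₂ → Reducible t₂ → Reducible t
        via t≈t₂ (t₃ , t₂≈t₃ , T₃ , fewer) =
          t₃ , t≈t₂ ◅◅ t₂≈t₃ , T₃ , subst (count isVertical t₃ <_) (ℕP.+-cancelˡ-≡ 2 _ _ (trans (sym count₂) count₁)) fewer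
        transport : ∀ {p z} → suc (suc a) < p → Vert t p z → Vert t₂ p z
        transport a+2<p p↑ = let p≢a , p≢a+1 , p≢a+2 = beyond a a+2<p in
          frame-vert frame₂ (<len a+2<) p≢a p≢a+1 (frame-vert frame₁ a+2< p≢a+1 p≢a+2 p↑)
        a+2↑₂ : Vert t₂ (suc (suc a)) z
        a+2↑₂ = frame-vert frame₂ (<len a+2<) (a≢a+2 ∘ sym) (ℕP.<⇒≢ (ℕP.n<1+n (suc a)) ∘ sym) (a+2< , a+2↑₁)
        b↑₂ : Vert t₂ (n + suc (suc (suc a))) z
        b↑₂ = subst (λ p → Vert t₂ p z) (sym (shift₂ n)) (transport (b-far n) b↑)
        flats₂ : ∀ {j} → j < n → Flat t₂ (j + suc (suc (suc a))) z
        flats₂ {j} j<n = subst (λ p → Flat t₂ p z) (sym (shift₂ j))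
          (frame-flat frame₂ (<len a+2<) p< p≢a p≢a+1 (frame-flat frame₁ a+2< p< p≢a+1 p≢a+2 (flats (s≤s (s≤s j<n)))))
          where
          p< : suc (suc (j + suc a)) < len
          p< = ℕP.<-trans (s≤s (s≤s (ℕP.+-monoˡ-< (suc a) j<n))) b<
          p≢a,a+1,a+2 = beyond a (b-far j)
          p≢a = proj₁ p≢a,a+1,a+2
          p≢a+1 = proj₁ (proj₂ p≢a,a+1,a+2)
          p≢a+2 = proj₂ (proj₂ p≢a,a+1,a+2)

      upper< : ∀ {j} → j < suc n → j + suc (suc a) < len
      upper< {j} j<1+n = subst (_< len) (sym (ℕP.+-suc j (suc a))) (ℕP.<-trans (s≤s (ℕP.+-monoˡ-< (suc a) j<1+n)) b<)

      upper-flat : ∀ {j} → j < suc n → ¬ Vert t (j + suc (suc a)) (suc z) → Flat t (j + suc (suc a)) (suc z)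
      upper-flat {j} j<1+n ¬j↑ with classify-pos T (upper< j<1+n) (top<N T a↑)
      ... | inj₁ j↑ = ⊥-elim (¬j↑ j↑)
      ... | inj₂ (inj₁ (_ , refl , j↑)) =
            ⊥-elim (vert-flat T j↑ (subst (λ p → Flat t p z) (sym (ℕP.+-suc j (suc a))) (flats (s≤s j<1+n))))
      ... | inj₂ (inj₂ flat) = flat

      search-branch : Vert t (suc a) (suc z) → Reducible t
      search-branch a+1↑ with first (λ j → Vert? t (j + suc (suc a)) (suc z)) (suc n)
      ... | inj₂ (m , m<1+n , m↑ , none-below) =
            rec (ℕP.<-trans m<1+n (ℕP.n<1+n (suc n))) T a+1↑ m↑
                (λ j<m → upper-flat (ℕP.<-trans j<m m<1+n) (none-below j<m))
      ... | inj₁ none = ⊥-elim (even⇒¬even-suc n lower-even upper-even)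
        where
        lower-even : Even (suc (suc n))
        lower-even = segment-even T (suc a) (suc (suc n)) flats
          (λ where refl a~a+1 → vert-flat T a↑ (inj₁ a~a+1))
          (λ where refl b-1~b → vert-flat T b↑ (inj₂ (_ , refl , b-1~b)))
        upper-even : Even (suc n)
        upper-even = segment-even T (suc (suc a)) (suc n) (λ j< → upper-flat j< (none j<))
          (λ where refl a+1~a+2⁺ → vert-flat T a+1↑ (inj₁ a+1~a+2⁺))
          (λ where refl b-1~b⁺ → vert-flat-above T b↑ (inj₂ (_ , cong suc (sym (ℕP.+-suc n (suc a))) , b-1~b⁺)))

      reducible : Reducible t
      reducible with classify-pos T (<len a+2<) (top<N T a↑)
      ... | inj₁ a+1↑ = search-branch a+1↑
      ... | inj₂ (inj₁ (_ , refl , a+1↑)) = ⊥-elim (vert-flat T a+1↑ (inj₁ a+1~a+2))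
      ... | inj₂ (inj₂ (inj₁ a+1~a+2⁺)) = flip-branch a+1~a+2⁺
      ... | inj₂ (inj₂ (inj₂ (_ , refl , a~a+1⁺))) = ⊥-elim (vert-flat-above T a↑ (inj₁ a~a+1⁺))

    gap-step : ∀ n → (∀ {m} → m < n → Gap m) → Gap n
    gap-step zero _ T a↑ a+1↑ _ = vertical-pair T a↑ a+1↑
    gap-step (suc zero) _ T a↑ a+2↑ flats with flats {0} (s≤s z≤n)
    ... | inj₁ a+1~a+2 = ⊥-elim (vert-flat T a+2↑ (inj₂ (_ , refl , a+1~a+2)))
    ... | inj₂ (_ , refl , a~a+1) = ⊥-elim (vert-flat T a↑ (inj₁ a~a+1))
    gap-step (suc (suc n)) rec T a↑ b↑ flats = WideGap.reducible n rec T a↑ b↑ flats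

  gap⇒reducible : ∀ n → Gap n
  gap⇒reducible = <-rec Gap gap-step

  private
    module Lowest {t a z₀} (T : IsTiling (Prism D N) t) (a↑ : Vert t a z₀)
                  (none-lower : ∀ {z} → z < z₀ → ¬ (∃[ k ] k < len × Vert t k z))
                  (none-left : ∀ {k} → k < a → ¬ Vert t k z₀) where

      row-flat : ∀ {p} → p < len → ¬ Vert t p z₀ → Flat t p z₀
      row-flat p< ¬p↑ with classify-pos T p< (ℕP.<-trans (ℕP.n<1+n _) (top<N T a↑))
      ... | inj₁ p↑ = ⊥-elim (¬p↑ p↑)
      ... | inj₂ (inj₁ (z' , refl , p↑)) = ⊥-elim (none-lower (ℕP.n<1+n z') (_ , p< , p↑))
      ... | inj₂ (inj₂ flat) = flat

      -- The cubes left of a are joined in pairs, so the parity of len forces a second vertical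
      -- domino to the right of a.
      reducible : Even len → Reducible t
      reducible even-len with first (λ j → Vert? t (j + suc a) z₀) (len ∸ suc a)
      ... | inj₂ (m , _ , m↑ , none-between) =
            gap⇒reducible m T a↑ m↑ λ j<m → row-flat (ℕP.<-trans (ℕP.+-monoˡ-< (suc a) j<m) (proj₁ m↑)) (none-between j<m)
      ... | inj₁ none-right = ⊥-elim (even⇒¬even-suc (r + a) (even-+ r a right-even left-even)
                                        (subst Even len≡ even-len))
        where
        r = len ∸ suc a
        len≡ : len ≡ suc (r + a)
        len≡ = trans (sym (ℕP.m∸n+n≡m (proj₁ a↑))) (ℕP.+-suc r a)
        right-even : Even r
        right-even = segment-even T (suc a) r
          (λ j<r → row-flat (subst (_ <_) (ℕP.m∸n+n≡m (proj₁ a↑)) (ℕP.+-monoˡ-< (suc a) j<r)) (none-right j<r))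
          (λ where refl a~a+1 → vert-flat T a↑ (inj₁ a~a+1))
          (λ j+1≡r (last< , _) → ℕP.<-irrefl (trans (cong (_+ suc a) j+1≡r) (ℕP.m∸n+n≡m (proj₁ a↑))) last<)
        left-even : Even a
        left-even = segment-even T 0 a
          (λ {j} j<a → subst (λ p → Flat t p z₀) (sym (ℕP.+-identityʳ j))
                         (row-flat (ℕP.<-trans j<a (proj₁ a↑)) (none-left j<a)))
          (λ ())
          (λ {j} j+1≡a j~a → vert-flat T a↑ (inj₂ (j + 0 , trans (sym j+1≡a) (cong suc (sym (ℕP.+-identityʳ j))) , j~a)))

  reduce-vertical : Even len → IsTiling (Prism D N) t → 0 < count isVertical t → Reducible t
  reduce-vertical {t} even-len T pos with vertical-domino T pos
  ... | x , z , x∈ , x↑ with cell-surjective x∈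
  ...   | k , k< , refl with first-witness (λ z → anyUpTo? (λ k → Vert? t k z) len) (k , k< , k< , x↑)
  ...     | z₀ , (k₀ , _ , k₀↑) , none-lower with first-witness (λ k → Vert? t k z₀) k₀↑
  ...       | a , a↑ , none-left = Lowest.reducible T a↑ none-lower none-left even-len

  private
    module Canonical {t} (T : IsTiling (Prism D N) t) (no-vertical : count isVertical t ≡ 0) where

      flat : k < len → z < N → Flat t k z
      flat k< z< with classify-pos T k< z<
      ... | inj₁ (_ , k↑) = ⊥-elim (ℕP.<-irrefl (sym no-vertical) (Up⇒count>0 k↑))
      ... | inj₂ (inj₁ (_ , _ , _ , k↑)) = ⊥-elim (ℕP.<-irrefl (sym no-vertical) (Up⇒count>0 k↑))
      ... | inj₂ (inj₂ f) = f

      horiz-at-even : z < N → Even k → k < len → Horiz t k z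
      horiz-at-even z< = Row.even-joined (horiz-disjoint T) (λ k< → flat k< z<) _

      horiz⇒even : z < N → Horiz t k z → Even k
      horiz⇒even {k = k} z< k~k+1 with Even? k
      ... | yes ek = ek
      ... | no ¬ek with odd⇒suc-even k ¬ek
      ...   | j , refl , ej = ⊥-elim (horiz-disjoint T (horiz-at-even z< ej (<len (<len (proj₁ k~k+1)))) k~k+1)

    horiz-⊆ : ∀ {t t' m z d} → IsTiling (Prism D N) t → IsTiling (Prism D N) t' →
              count isVertical t ≡ 0 → count isVertical t' ≡ 0 → z < N → Horiz t m z → d ∈ t →
              covers d ⟦ m , z ⟧ ≡ 1 ⊎ covers d ⟦ suc m , z ⟧ ≡ 1 → d ∈ t'
    horiz-⊆ {t' = t'} {m} {z} {d} T T' t-flat t'-flat z< m~m+1@(m+1< , d₁ , d₁∈ , j₁) d∈ covers-d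
      with Canonical.horiz-at-even T' t'-flat z< (Canonical.horiz⇒even T t-flat z< m~m+1) (<len m+1<)
    ... | _ , d₂ , d₂∈ , j₂ = subst (_∈ t') (sym (trans d≡d₁ (joins-injective m≢m+1 j₁ j₂))) d₂∈
      where
      d≡d₁ : d ≡ d₁
      d≡d₁ = [ (λ cm → cover-unique T d∈ d₁∈ cm (proj₁ j₁)) , (λ cm+1 → cover-unique T d∈ d₁∈ cm+1 (proj₂ j₁)) ]′ covers-d
      m≢m+1 : ⟦ m , z ⟧ ≢ ⟦ suc m , z ⟧
      m≢m+1 eq = ℕP.<⇒≢ (ℕP.n<1+n m) (cell-injective (<len m+1<) m+1< (proj₁ (cube-injective eq)))

  canonical-⊆ : ∀ {t t'} → IsTiling (Prism D N) t → IsTiling (Prism D N) t' →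
                count isVertical t ≡ 0 → count isVertical t' ≡ 0 → ∀ {d} → d ∈ t → d ∈ t'
  canonical-⊆ {t} {t'} T T' t-flat t'-flat {c , i} d∈ with ∈⇒cube (covers⇒∈R T d∈ (covers-base c i))
  ... | x , z , refl , x∈ , z< with cell-surjective x∈
  ...   | k , k< , refl with Canonical.flat T t-flat k< z<
  ...     | inj₁ k~k+1 = horiz-⊆ T T' t-flat t'-flat z< k~k+1 d∈ (inj₁ (covers-base _ i))
  ...     | inj₂ (j , refl , j~k) = horiz-⊆ T T' t-flat t'-flat z< j~k d∈ (inj₂ (covers-base _ i))

  flip-connected : Even len → ∀ {t₀ t₁} → IsTiling (Prism D N) t₀ → IsTiling (Prism D N) t₁ → t₀ ≈ t₁
  flip-connected even-len T₀ T₁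
    with remove-verticals (reduce-vertical even-len) T₀ | remove-verticals (reduce-vertical even-len) T₁
  ... | c₀ , t₀≈c₀ , C₀ , c₀-flat | c₁ , t₁≈c₁ , C₁ , c₁-flat =
    t₀≈c₀ ◅◅ ↭⇒≈ (⊆⇒↭ C₀ C₁ (canonical-⊆ C₀ C₁ c₀-flat c₁-flat)) ◅◅ ≈-sym t₁≈c₁

-- Prisms over the 2 × 2 square

module Square (a b : ℤ) where

  bump : Bool → ℤ → ℤ
  bump false i = i
  bump true i = i ℤ.+ 1ℤ

  sq : Bool → Bool → Cell
  sq i j = (bump i a , bump j b)

  private
    bump-injective : ∀ i i' c → bump i c ≡ bump i' c → i ≡ i'
    bump-injective false false _ _ = refl
    bump-injective false true c eq = ⊥-elim (i≢i+1 c eq)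
    bump-injective true false c eq = ⊥-elim (i≢i+1 c (sym eq))
    bump-injective true true _ _ = refl

    diff : Bool → Bool → ℕ
    diff false false = 0
    diff false true = 1
    diff true false = 1
    diff true true = 0

    ∣bump-bump∣ : ∀ i i' c → ∣ bump i c ℤ.- bump i' c ∣ ≡ diff i i'
    ∣bump-bump∣ false false c = cong ∣_∣ (ℤP.+-inverseʳ c)
    ∣bump-bump∣ false true c = cong ∣_∣ (lemma c)
      where
      lemma : ∀ c → c ℤ.- (c ℤ.+ 1ℤ) ≡ -1ℤ
      lemma = solve-∀
    ∣bump-bump∣ true false c = cong ∣_∣ (lemma c)
      where
      lemma : ∀ c → c ℤ.+ 1ℤ ℤ.- c ≡ 1ℤ
      lemma = solve-∀
    ∣bump-bump∣ true true c = cong ∣_∣ (ℤP.+-inverseʳ (c ℤ.+ 1ℤ))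

    Adj4-sq : ∀ {i j i' j'} → Adj4 (sq i j) (sq i' j') → diff i i' + diff j j' ≡ 1
    Adj4-sq {i} {j} {i'} {j'} adj = trans (sym (cong₂ _+_ (∣bump-bump∣ i i' a) (∣bump-bump∣ j j' b))) adj

  sq-injective : ∀ {i j i' j'} → sq i j ≡ sq i' j' → i ≡ i' × j ≡ j'
  sq-injective {i} {j} {i'} {j'} eq = bump-injective i i' a (cong proj₁ eq) , bump-injective j j' b (cong proj₂ eq)

  sq-neighbours : ∀ {i j i' j'} → Adj4 (sq i j) (sq i' j') → (i' ≡ not i × j' ≡ j) ⊎ (i' ≡ i × j' ≡ not j)
  sq-neighbours {i} {j} {i'} {j'} adj with i | i' | j | j' | Adj4-sq {i} {j} {i'} {j'} adj
  ... | false | true | false | false | _ = inj₁ (refl , refl)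
  ... | false | true | true | true | _ = inj₁ (refl , refl)
  ... | true | false | false | false | _ = inj₁ (refl , refl)
  ... | true | false | true | true | _ = inj₁ (refl , refl)
  ... | false | false | false | true | _ = inj₂ (refl , refl)
  ... | false | false | true | false | _ = inj₂ (refl , refl)
  ... | true | true | false | true | _ = inj₂ (refl , refl)
  ... | true | true | true | false | _ = inj₂ (refl , refl)

  sq-Adj4ᵢ : ∀ i j → Adj4 (sq i j) (sq (not i) j)
  sq-Adj4ᵢ i j = trans (cong₂ _+_ (∣bump-bump∣ i (not i) a) (∣bump-bump∣ j j b)) (lemma i j)
    where
    lemma : ∀ i j → diff i (not i) + diff j j ≡ 1
    lemma false false = refl
    lemma false true = refl
    lemma true false = refl
    lemma true true = refl

  sq-Adj4ⱼ : ∀ i j → Adj4 (sq i j) (sq i (not j))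
  sq-Adj4ⱼ i j = trans (cong₂ _+_ (∣bump-bump∣ i i a) (∣bump-bump∣ j (not j) b)) (lemma i j)
    where
    lemma : ∀ i j → diff i i + diff j (not j) ≡ 1
    lemma false false = refl
    lemma false true = refl
    lemma true false = refl
    lemma true true = refl

  sq≢ᵢ : ∀ i j → sq i j ≢ sq (not i) j
  sq≢ᵢ i j eq = not-¬ refl (proj₁ (sq-injective {i} {j} {not i} {j} eq))

  sq≢ⱼ : ∀ i j → sq i j ≢ sq i (not j)
  sq≢ⱼ i j eq = not-¬ refl (proj₂ (sq-injective {i} {j} {i} {not j} eq))

  sq≢ᵢⱼ : ∀ i j → sq (not i) j ≢ sq i (not j)
  sq≢ᵢⱼ i j eq = not-¬ refl (proj₂ (sq-injective {not i} {j} {i} {not j} eq))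

  IsSquare : List Cell → Set
  IsSquare D = (∀ {y} → y ∈ D → ∃[ i ] ∃[ j ] y ≡ sq i j) × (∀ i j → sq i j ∈ D)

  isNorth : Domino → ℕ
  isNorth (_ , north) = 1
  isNorth (_ , east) = 0
  isNorth (_ , up) = 0

  module SquareTiling {D : List Cell} (N : ℕ) (square : IsSquare D) where
    open PrismTiling D N

    private
      corner = proj₁ square
      sq∈ = proj₂ square

    private
      variable
        t : List Domino
        z : ℕ

      neighbour : ∀ i j {y} → y ∈ D → Adj4 (sq i j) y → y ≡ sq (not i) j ⊎ y ≡ sq i (not j)
      neighbour i j y∈ adj with corner y∈
      ... | i' , j' , refl with sq-neighbours {i} {j} {i'} {j'} adj
      ...   | inj₁ (refl , refl) = inj₁ refl
      ...   | inj₂ (refl , refl) = inj₂ refl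

    -- If neither neighbour of the corner starts a vertical domino at level z, both are joined to the
    -- opposite corner, since no vertical domino ends at level z.
    lowest-corner⇒reducible : ∀ i j → IsTiling (Prism D N) t → Up t (sq i j) z →
                        (∀ {z'} → z' < z → ¬ Any (λ y → Up t y z') D) → Reducible t
    lowest-corner⇒reducible {t} {z} i j T u↑ none-lower = go (Up? t (sq (not i) j) z) (Up? t (sq i (not j)) z)
      where
      u = sq i j
      o = sq (not i) (not j)
      towards-opposite : ∀ {n} → n ∈ D → u ≢ n → ¬ Up t n z →
                         (∀ {y} → y ∈ D → Adj4 n y → y ≡ u ⊎ y ≡ o) → Level t n o z
      towards-opposite {n} n∈ u≢n ¬n↑ nbrs with classify T n∈ (ℕP.<-trans (ℕP.n<1+n z) (Up⇒<N T u↑))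
      ... | inj₁ n↑ = ⊥-elim (¬n↑ n↑)
      ... | inj₂ (inj₁ (z' , refl , n↑)) = ⊥-elim (none-lower (ℕP.n<1+n z') (lose n∈ n↑))
      ... | inj₂ (inj₂ (y , y∈ , n~y , level)) with nbrs y∈ n~y
      ...   | inj₂ refl = level
      ...   | inj₁ refl = ⊥-elim (ℕP.<⇒≢ (ℕP.n<1+n z) (proj₂ (same-partner T (Matched-sym level) u↑ (cube≢ˣ u≢n) (cube≢ᶻ (ℕP.<⇒≢ (ℕP.n<1+n z))))))
      go : Dec (Up t (sq (not i) j) z) → Dec (Up t (sq i (not j)) z) → Reducible t
      go (yes n₁↑) _ = vertical-pair⇒reducible T (sq-Adj4ᵢ i j) u↑ n₁↑
      go (no _) (yes n₂↑) = vertical-pair⇒reducible T (sq-Adj4ⱼ i j) u↑ n₂↑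
      go (no ¬n₁↑) (no ¬n₂↑) =
        ⊥-elim (sq≢ᵢⱼ i j (proj₁ (same-partner T (Matched-sym o~n₁) (Matched-sym o~n₂) (cube≢ˣ (sq≢ⱼ (not i) j ∘ sym)) (cube≢ˣ (sq≢ᵢ i (not j) ∘ sym)))))
        where
        o~n₁ : Level t (sq (not i) j) o z
        o~n₁ = towards-opposite (sq∈ (not i) j) (sq≢ᵢ i j) ¬n₁↑ λ y∈ adj → case neighbour (not i) j y∈ adj of λ where
          (inj₁ refl) → inj₁ (cong (λ i → sq i j) (not-involutive i))
          (inj₂ refl) → inj₂ refl
        o~n₂ : Level t (sq i (not j)) o z
        o~n₂ = towards-opposite (sq∈ i (not j)) (sq≢ⱼ i j) ¬n₂↑ λ y∈ adj → case neighbour i (not j) y∈ adj of λ where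
          (inj₁ refl) → inj₂ refl
          (inj₂ refl) → inj₁ (cong (sq i) (not-involutive j))

    reduce-vertical : IsTiling (Prism D N) t → 0 < count isVertical t → Reducible t
    reduce-vertical {t} T pos with vertical-domino T pos
    ... | x , z , x∈ , x↑ with first-witness (λ z → any? (λ y → Up? t y z) D) (lose x∈ x↑)
    ...   | z₀ , some , none-lower with find some
    ...     | y , y∈ , y↑ with corner y∈
    ...       | i , j , refl = lowest-corner⇒reducible i j T y↑ none-lower

    private
      flat-corner : ∀ i j → IsTiling (Prism D N) t → count isVertical t ≡ 0 → z < N →
                    Level t (sq i j) (sq (not i) j) z ⊎ Level t (sq i j) (sq i (not j)) z
      flat-corner i j T no-vertical z< with classify T (sq∈ i j) z<
      ... | inj₁ u↑ = ⊥-elim (ℕP.<-irrefl (sym no-vertical) (Up⇒count>0 u↑))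
      ... | inj₂ (inj₁ (_ , _ , u↑)) = ⊥-elim (ℕP.<-irrefl (sym no-vertical) (Up⇒count>0 u↑))
      ... | inj₂ (inj₂ (y , y∈ , adj , level)) with neighbour i j y∈ adj
      ...   | inj₁ refl = inj₁ level
      ...   | inj₂ refl = inj₂ level

      column : ∀ i j → Level t (sq i j) (sq i (not j)) z → Level t (sq i false) (sq i true) z
      column i false level = level
      column i true level = Matched-sym level

      column⇒north : ∀ i j → Level t (sq i j) (sq i (not j)) z → 0 < count isNorth t
      column⇒north {t} {z} i j level = ∈⇒≤count isNorth
        (matched-shift⇒∈ (subst (Matched t (cube (sq i false) z)) (cube-shiftᶜ (suc zero) (sq i false) z)
                                (column i j level)))

      other-column : ∀ i j → IsTiling (Prism D N) t → count isVertical t ≡ 0 → z < N →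
                     Level t (sq i j) (sq i (not j)) z → Level t (sq (not i) j) (sq (not i) (not j)) z
      other-column i j T no-vertical z< level with flat-corner (not i) j T no-vertical z<
      ... | inj₂ level' = level'
      ... | inj₁ level' = ⊥-elim (sq≢ᵢⱼ i j (sym (proj₁ (same-partner T level
              (subst (λ i' → Level _ i' (sq (not i) j) _) (cong (λ i' → sq i' j) (not-involutive i)) (Matched-sym level'))
              (cube≢ˣ (sq≢ⱼ i j)) (cube≢ˣ (sq≢ᵢ i j))))))

    private
      Flat : List Domino → Set
      Flat t = IsTiling (Prism D N) t × count isVertical t ≡ 0

      north-column : ∀ i j → IsTiling (Prism D N) t → Level t (sq i j) (shiftᶜ (suc zero) (sq i j)) z →
                     Level t (sq i j) (sq i (not j)) z
      north-column {t} {z} i j T level with neighbour i j (proj₁ (matched⇒∈R T level)) (Adj4-shiftᶜ (suc zero) (sq i j))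
      ... | inj₁ eq = ⊥-elim (not-¬ refl (bump-injective i (not i) a (cong proj₁ eq)))
      ... | inj₂ eq = subst Level′ eq level
        where
        Level′ : Cell → Set
        Level′ y = Level t (sq i j) y z

      flip-columns : Flat t → z < N → Level t (sq false false) (sq false true) z →
                     Level t (sq true false) (sq true true) z →
                     ∃[ t' ] t ≈ t' × Flat t' × count isNorth t' < count isNorth t
      flip-columns {t} {z} (T , no-vertical) z< col₀ col₁
        with flip-square {i = north} {j = east} T (λ ()) (cube-shiftᶜ (suc zero) (sq false false) z) (cube-shiftᶜ zero (sq false false) z)
                         (cube-shiftᶜ zero (sq false true) z) col₀ col₁
      ... | t' , t≈t' , T' , _ , _ , _ , weights =
        t' , t≈t' , (T' , ℕP.+-cancelʳ-≡ _ _ 0 (trans (sym (weights isVertical)) (cong (_+ 0) no-vertical))) ,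
        subst (count isNorth t' <_) (sym (trans (sym (ℕP.+-identityʳ _)) (trans (weights isNorth) (ℕP.+-comm _ 2))))
              (ℕP.m<n+m _ (s≤s z≤n))

    reduce-north : Flat t → 0 < count isNorth t →
                   ∃[ t' ] t ≈ t' × Flat t' × count isNorth t' < count isNorth t
    reduce-north {t} (T , no-vertical) pos with count>0⇒∃ isNorth t pos
    ... | (c , east) , _ , ()
    ... | (c , up) , _ , ()
    ... | (c , north) , d∈ , _ with ∈⇒cube (covers⇒∈R T d∈ (covers-base c north))
    ...   | x , z , refl , x∈ , z< with corner x∈
    ...     | i , j , refl = flip-both i (north-column i j T north-pair)
      where
      north-pair : Level t (sq i j) (shiftᶜ (suc zero) (sq i j)) z
      north-pair = subst (Matched t (cube (sq i j) z)) (sym (cube-shiftᶜ (suc zero) (sq i j) z)) (∈⇒matched-shift d∈)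
      flip-both : ∀ i → Level t (sq i j) (sq i (not j)) z → ∃[ t' ] t ≈ t' × Flat t' × count isNorth t' < count isNorth t
      flip-both false level = flip-columns (T , no-vertical) z<
        (column false j level) (column true j (other-column false j T no-vertical z< level))
      flip-both true level = flip-columns (T , no-vertical) z<
        (column false j (other-column true j T no-vertical z< level)) (column true j level)

    private
      canonical-level : ∀ i j → IsTiling (Prism D N) t → count isVertical t ≡ 0 → count isNorth t ≡ 0 → z < N →
                        Level t (sq i j) (sq (not i) j) z
      canonical-level i j T no-vertical no-north z< with flat-corner i j T no-vertical z<
      ... | inj₁ level = level
      ... | inj₂ level = ⊥-elim (ℕP.<-irrefl (sym no-north) (column⇒north i j level))

      canonical-⊆ : ∀ {t t'} → Flat t → Flat t' → count isNorth t ≡ 0 → count isNorth t' ≡ 0 →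
                    ∀ {d} → d ∈ t → d ∈ t'
      canonical-⊆ {t} {t'} (T , t-flat) (T' , t'-flat) t-no-north t'-no-north {c , k} d∈
        with ∈⇒cube (covers⇒∈R T d∈ (covers-base c k))
      ... | x , z , refl , x∈ , z< with corner x∈
      ...   | i , j , refl with canonical-level i j T t-flat t-no-north z< | canonical-level i j T' t'-flat t'-no-north z<
      ...     | d₁ , d₁∈ , joins₁ | d₂ , d₂∈ , joins₂ =
                subst (_∈ t') (sym (trans (cover-unique T d∈ d₁∈ (covers-base _ k) (proj₁ joins₁))
                                          (joins-injective (cube≢ˣ (sq≢ᵢ i j)) joins₁ joins₂))) d₂∈

    flip-connected : ∀ {t₀ t₁} → IsTiling (Prism D N) t₀ → IsTiling (Prism D N) t₁ → t₀ ≈ t₁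
    flip-connected T₀ T₁ with remove-verticals reduce-vertical T₀ | remove-verticals reduce-vertical T₁
    ... | v₀ , t₀≈v₀ , V₀ , v₀-flat | v₁ , t₁≈v₁ , V₁ , v₁-flat
        with descend _ Flat (count isNorth) reduce-north (V₀ , v₀-flat)
           | descend _ Flat (count isNorth) reduce-north (V₁ , v₁-flat)
    ...   | c₀ , v₀≈c₀ , C₀ , c₀-no-north | c₁ , v₁≈c₁ , C₁ , c₁-no-north =
            t₀≈v₀ ◅◅ v₀≈c₀ ◅◅ ↭⇒≈ (⊆⇒↭ (proj₁ C₀) (proj₁ C₁) (canonical-⊆ C₀ C₁ c₀-no-north c₁-no-north))
                  ◅◅ ≈-sym v₁≈c₁ ◅◅ ≈-sym t₁≈v₁

-- Crossing numbers

unshiftᶜ : Fin 2 → Cell → Cell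
unshiftᶜ zero (a , b) = (a ℤ.- 1ℤ , b)
unshiftᶜ (suc zero) (a , b) = (a , b ℤ.- 1ℤ)

right left above below : Cell → Cell
right = shiftᶜ zero
left = unshiftᶜ zero
above = shiftᶜ (suc zero)
below = unshiftᶜ (suc zero)

private
  i-1+1≡i : ∀ i → i ℤ.- 1ℤ ℤ.+ 1ℤ ≡ i
  i-1+1≡i = solve-∀

  i+1-1≡i : ∀ i → i ℤ.+ 1ℤ ℤ.- 1ℤ ≡ i
  i+1-1≡i = solve-∀

shiftᶜ-unshiftᶜ : ∀ j x → shiftᶜ j (unshiftᶜ j x) ≡ x
shiftᶜ-unshiftᶜ zero (a , b) = cong (_, b) (i-1+1≡i a)
shiftᶜ-unshiftᶜ (suc zero) (a , b) = cong (a ,_) (i-1+1≡i b)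

unshiftᶜ-shiftᶜ : ∀ j x → unshiftᶜ j (shiftᶜ j x) ≡ x
unshiftᶜ-shiftᶜ zero (a , b) = cong (_, b) (i+1-1≡i a)
unshiftᶜ-shiftᶜ (suc zero) (a , b) = cong (a ,_) (i+1-1≡i b)

neighbourhood : Cell → List Cell
neighbourhood x = right x ∷ left x ∷ above x ∷ below x ∷ []

Adj4⇔∈neighbourhood : ∀ x y → Adj4 x y ⇔ y ∈ neighbourhood x
Adj4⇔∈neighbourhood x y = mk⇔ to from
  where
  to : Adj4 x y → y ∈ neighbourhood x
  to adj with Adj4⇒shiftᶜ {x} {y} adj
  ... | zero , inj₁ refl = here refl
  ... | zero , inj₂ refl = there (here (sym (unshiftᶜ-shiftᶜ zero y)))
  ... | suc zero , inj₁ refl = there (there (here refl))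
  ... | suc zero , inj₂ refl = there (there (there (here (sym (unshiftᶜ-shiftᶜ (suc zero) y)))))
  from-unshift : ∀ j → Adj4 x (unshiftᶜ j x)
  from-unshift j = subst (λ x' → Adj4 x' (unshiftᶜ j x)) (shiftᶜ-unshiftᶜ j x)
                     (Adj4-sym {unshiftᶜ j x} {shiftᶜ j (unshiftᶜ j x)} (Adj4-shiftᶜ j (unshiftᶜ j x)))
  from : y ∈ neighbourhood x → Adj4 x y
  from (here refl) = Adj4-shiftᶜ zero x
  from (there (here refl)) = from-unshift zero
  from (there (there (here refl))) = Adj4-shiftᶜ (suc zero) x
  from (there (there (there (here refl)))) = from-unshift (suc zero)

neighbourhood-unique : ∀ x → Unique (neighbourhood x)
neighbourhood-unique (a , b) =
  (r≢l ∷ r≢a ∷ r≢b ∷ []) ∷ (l≢a ∷ l≢b ∷ []) ∷ (a≢b ∷ []) ∷ [] ∷ []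
  where
  +1≢-1 : ∀ i → i ℤ.+ 1ℤ ≢ i ℤ.- 1ℤ
  +1≢-1 i eq = i≢i+1+1 (i ℤ.- 1ℤ) (sym (trans (i-1+1+1≡i+1 i) eq))
    where
    i-1+1+1≡i+1 : ∀ i → i ℤ.- 1ℤ ℤ.+ 1ℤ ℤ.+ 1ℤ ≡ i ℤ.+ 1ℤ
    i-1+1+1≡i+1 = solve-∀
  +1≢ : ∀ i → i ℤ.+ 1ℤ ≢ i
  +1≢ i eq = i≢i+1 i (sym eq)
  -1≢ : ∀ i → i ℤ.- 1ℤ ≢ i
  -1≢ i eq = i≢i+1 (i ℤ.- 1ℤ) (trans eq (sym (i-1+1≡i i)))
  r≢l = +1≢-1 a ∘ cong proj₁
  r≢a = +1≢ a ∘ cong proj₁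
  r≢b = +1≢ a ∘ cong proj₁
  l≢a = -1≢ a ∘ cong proj₁
  l≢b = -1≢ a ∘ cong proj₁
  a≢b = +1≢-1 b ∘ cong proj₂

private
  <⇔+1<⊎≡+1 : ∀ a j → (a ℤ.< j) ⇔ (a ℤ.+ 1ℤ ℤ.< j ⊎ j ≡ a ℤ.+ 1ℤ)
  <⇔+1<⊎≡+1 a j = mk⇔ to from
    where
    a<a+1 : a ℤ.< a ℤ.+ 1ℤ
    a<a+1 = ℤP.suc[i]≤j⇒i<j (ℤP.≤-reflexive (ℤP.+-comm 1ℤ a))
    to : a ℤ.< j → a ℤ.+ 1ℤ ℤ.< j ⊎ j ≡ a ℤ.+ 1ℤ
    to a<j with j ℤ.≟ a ℤ.+ 1ℤ
    ... | yes j≡a+1 = inj₂ j≡a+1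
    ... | no j≢a+1 = inj₁ (ℤP.≤∧≢⇒< (subst (ℤ._≤ j) (ℤP.+-comm 1ℤ a) (ℤP.i<j⇒suc[i]≤j a<j)) (j≢a+1 ∘ sym))
    from : a ℤ.+ 1ℤ ℤ.< j ⊎ j ≡ a ℤ.+ 1ℤ → a ℤ.< j
    from (inj₁ a+1<j) = ℤP.<-trans a<a+1 a+1<j
    from (inj₂ refl) = a<a+1

  <+1⇔<⊎≡ : ∀ a j → (a ℤ.< j ℤ.+ 1ℤ) ⇔ (a ℤ.< j ⊎ j ≡ a)
  <+1⇔<⊎≡ a j = mk⇔ to from
    where
    j<j+1 : j ℤ.< j ℤ.+ 1ℤ
    j<j+1 = ℤP.suc[i]≤j⇒i<j (ℤP.≤-reflexive (ℤP.+-comm 1ℤ j))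
    to : a ℤ.< j ℤ.+ 1ℤ → a ℤ.< j ⊎ j ≡ a
    to a<j+1 with j ℤ.≟ a
    ... | yes j≡a = inj₂ j≡a
    ... | no j≢a = inj₁ (ℤP.≤∧≢⇒< a≤j (j≢a ∘ sym))
      where
      a≤j : a ℤ.≤ j
      a≤j = subst₂ ℤ._≤_ (cancel a) (trans (cong (λ k → -1ℤ ℤ.+ k) (ℤP.+-comm j 1ℤ)) (cancel j))
                   (ℤP.+-monoʳ-≤ -1ℤ (ℤP.i<j⇒suc[i]≤j a<j+1))
        where
        cancel : ∀ i → -1ℤ ℤ.+ (1ℤ ℤ.+ i) ≡ i
        cancel = solve-∀
    from : a ℤ.< j ⊎ j ≡ a → a ℤ.< j ℤ.+ 1ℤ
    from (inj₁ a<j) = ℤP.<-trans a<j j<j+1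
    from (inj₂ refl) = j<j+1

  𝟙≟-subst : ∀ {y w} (h : Cell → ℕ) → 𝟙 (y ≟ᶜ w) * h y ≡ 𝟙 (y ≟ᶜ w) * h w
  𝟙≟-subst {y} {w} h with y ≟ᶜ w
  ... | yes refl = refl
  ... | no _ = refl

module Crossings (D : List Cell) where

  mult : Cell → ℕ
  mult w = count (λ y → 𝟙 (y ≟ᶜ w)) D

  mult-∉ : ∀ {w} → w ∉ D → mult w ≡ 0
  mult-∉ {w} w∉D = count-0 _ D λ {y} y∈D → 𝟙-no (y ≟ᶜ w) λ where refl → w∉D y∈D

  mult-∈ : ∀ {w} → Unique D → w ∈ D → mult w ≡ 1
  mult-∈ {w} uniq w∈D = begin
    count (λ y → 𝟙 (y ≟ᶜ w)) D   ≡⟨ count-cong _ _ D (λ {y} _ → 𝟙-cong (y ≟ᶜ w) (w ≟ᶜ y) (mk⇔ sym sym)) ⟩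
    count (λ y → 𝟙 (w ≟ᶜ y)) D   ≡⟨ count-≟-unique _≟ᶜ_ uniq w ⟩
    𝟙 (w ∈? D)                   ≡⟨ 𝟙-yes (w ∈? D) w∈D ⟩
    1                            ∎
    where open ≡-Reasoning

  count-𝟙≟* : ∀ w c → count (λ y → 𝟙 (y ≟ᶜ w) * c) D ≡ mult w * c
  count-𝟙≟* w c = trans (count-cong _ _ D λ {y} _ → ℕP.*-comm (𝟙 (y ≟ᶜ w)) c)
                        (trans (count-*ˡ c _ D) (ℕP.*-comm c (mult w)))

  mult>0⇒∈ : ∀ {w} → 0 < mult w → w ∈ D
  mult>0⇒∈ {w} pos with count>0⇒∃ (λ y → 𝟙 (y ≟ᶜ w)) D pos
  ... | y , y∈D , y≡w = subst (_∈ D) (𝟙-pos (y ≟ᶜ w) y≡w) y∈D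

  degree≡ : ∀ x → count (adjacency x) D ≡ count mult (neighbourhood x)
  degree≡ x = begin
    count (adjacency x) D                                              ≡⟨ count-cong _ _ D (λ {y} _ → pointwise y) ⟩
    count (λ y → count (λ w → 𝟙 (y ≟ᶜ w)) (neighbourhood x)) D         ≡⟨ count-swap (λ y w → 𝟙 (y ≟ᶜ w)) D (neighbourhood x) ⟩
    count mult (neighbourhood x)                                       ∎
    where
    open ≡-Reasoning
    pointwise : ∀ y → adjacency x y ≡ count (λ w → 𝟙 (y ≟ᶜ w)) (neighbourhood x)
    pointwise y = trans (𝟙-cong (Adj4? x y) (y ∈? neighbourhood x) (Adj4⇔∈neighbourhood x y))
                        (sym (count-≟-unique _≟ᶜ_ (neighbourhood-unique x) y))

  reindex : ∀ (σ τ : Cell → Cell) → (∀ x → τ (σ x) ≡ x) → (∀ x → σ (τ x) ≡ x) → (g : Cell → ℕ) →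
            count (λ y → g y * mult (τ y)) D ≡ count (λ z → g (σ z) * mult (σ z)) D
  reindex σ τ τσ στ g = begin
    count (λ y → g y * mult (τ y)) D                                 ≡⟨ count-cong _ _ D (λ {y} _ → sym (count-*ˡ (g y) _ D)) ⟩
    count (λ y → count (λ z → g y * 𝟙 (z ≟ᶜ τ y)) D) D               ≡⟨ count-cong _ _ D (λ {y} _ → count-cong _ _ D λ {z} _ → pointwise y z) ⟩
    count (λ y → count (λ z → g (σ z) * 𝟙 (y ≟ᶜ σ z)) D) D           ≡⟨ count-swap _ D D ⟩
    count (λ z → count (λ y → g (σ z) * 𝟙 (y ≟ᶜ σ z)) D) D           ≡⟨ count-cong _ _ D (λ {z} _ → count-*ˡ (g (σ z)) _ D) ⟩
    count (λ z → g (σ z) * mult (σ z)) D                             ∎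
    where
    open ≡-Reasoning
    pointwise : ∀ y z → g y * 𝟙 (z ≟ᶜ τ y) ≡ g (σ z) * 𝟙 (y ≟ᶜ σ z)
    pointwise y z with z ≟ᶜ τ y | y ≟ᶜ σ z
    ... | yes _ | yes refl = refl
    ... | yes refl | no y≢στy = ⊥-elim (y≢στy (sym (στ y)))
    ... | no z≢τσz | yes refl = ⊥-elim (z≢τσz (sym (τσ z)))
    ... | no _ | no _ = trans (ℕP.*-zeroʳ (g y)) (sym (ℕP.*-zeroʳ (g (σ z))))

  RightOf : ℤ → ℤ → Cell → Set
  RightOf a r (y₁ , y₂) = y₂ ≡ r × a ℤ.< y₁

  RightOf? : ∀ a r y → Dec (RightOf a r y)
  RightOf? a r (y₁ , y₂) = (y₂ ℤ.≟ r) ×-dec (a ℤ.<? y₁)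

  rowSum : ℤ → ℤ → (Cell → ℕ) → ℕ
  rowSum a r h = count (λ y → 𝟙 (RightOf? a r y) * h y) D

  -- The number of vertical edges of D crossing the ray to the right of a cell.
  crossings : Cell → ℕ
  crossings (a , r) = rowSum a r (mult ∘ shiftᶜ (suc zero))

  rowSum-split : ∀ a r h → rowSum a r h ≡ rowSum (a ℤ.+ 1ℤ) r h + mult (a ℤ.+ 1ℤ , r) * h (a ℤ.+ 1ℤ , r)
  rowSum-split a r h = begin
    rowSum a r h                                                     ≡⟨ count-cong _ _ D (λ {y} _ → pointwise y) ⟩
    count (λ y → 𝟙 (RightOf? a⁺ r y) * h y + 𝟙 (y ≟ᶜ w) * h w) D     ≡⟨ count-+ _ _ D ⟩
    rowSum a⁺ r h + count (λ y → 𝟙 (y ≟ᶜ w) * h w) D                 ≡⟨ cong (rowSum a⁺ r h +_) (count-𝟙≟* w (h w)) ⟩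
    rowSum a⁺ r h + mult w * h w                                     ∎
    where
    open ≡-Reasoning
    a⁺ = a ℤ.+ 1ℤ
    w = (a⁺ , r)
    pointwise : ∀ y → 𝟙 (RightOf? a r y) * h y ≡ 𝟙 (RightOf? a⁺ r y) * h y + 𝟙 (y ≟ᶜ w) * h w
    pointwise y@(y₁ , y₂) = begin
      𝟙 (RightOf? a r y) * h y                                    ≡⟨ cong (_* h y) split ⟩
      (𝟙 (RightOf? a⁺ r y) + 𝟙 (y ≟ᶜ w)) * h y                    ≡⟨ ℕP.*-distribʳ-+ (h y) (𝟙 (RightOf? a⁺ r y)) (𝟙 (y ≟ᶜ w)) ⟩
      𝟙 (RightOf? a⁺ r y) * h y + 𝟙 (y ≟ᶜ w) * h y                ≡⟨ cong (𝟙 (RightOf? a⁺ r y) * h y +_) (𝟙≟-subst {y} {w} h) ⟩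
      𝟙 (RightOf? a⁺ r y) * h y + 𝟙 (y ≟ᶜ w) * h w                ∎
      where
      split : 𝟙 (RightOf? a r y) ≡ 𝟙 (RightOf? a⁺ r y) + 𝟙 (y ≟ᶜ w)
      split = 𝟙-⊎ (RightOf? a r y) (RightOf? a⁺ r y) (y ≟ᶜ w)
        (mk⇔ (λ (y₂≡r , a<y₁) → case Equivalence.to (<⇔+1<⊎≡+1 a y₁) a<y₁ of λ where
                (inj₁ a⁺<y₁) → inj₁ (y₂≡r , a⁺<y₁)
                (inj₂ refl) → inj₂ (cong (_ ,_) y₂≡r))
             λ where
               (inj₁ (y₂≡r , a⁺<y₁)) → y₂≡r , Equivalence.from (<⇔+1<⊎≡+1 a y₁) (inj₁ a⁺<y₁)
               (inj₂ refl) → refl , Equivalence.from (<⇔+1<⊎≡+1 a y₁) (inj₂ refl))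
        λ where ((_ , a⁺<y₁) , refl) → ℤP.<-irrefl refl a⁺<y₁

  private
    rowSum-+ : ∀ a r f g → rowSum a r (λ y → f y + g y) ≡ rowSum a r f + rowSum a r g
    rowSum-+ a r f g = trans (count-cong _ _ D λ {y} _ → ℕP.*-distribˡ-+ (𝟙 (RightOf? a r y)) (f y) (g y))
                             (count-+ _ _ D)

  crossings-right : ∀ y → crossings y ≡ crossings (right y) + mult (right y) * mult (above (right y))
  crossings-right (a , r) = rowSum-split a r (mult ∘ above)

  horizontal-step : ∀ y → right y ∉ D → crossings y ≡ crossings (right y)
  horizontal-step y ey∉D = trans (crossings-right y) (trans (cong (λ m → crossings (right y) + m * mult (above (right y))) (mult-∉ ey∉D))
                                                           (ℕP.+-identityʳ _))

  module _ (degree-2 : ∀ {y} → y ∈ D → count (adjacency y) D ≡ 2) where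

    -- The degrees of the cells of D to the right of above y sum to an even number. Horizontal edges
    -- among them are counted twice, as above y ∉ D, and vertical ones give the two crossing numbers.
    vertical-step : ∀ y → above y ∉ D → crossings y % 2 ≡ crossings (above y) % 2
    vertical-step y@(a , r) ny∉D = begin
      crossings y % 2  ≡⟨ cong (_% 2) Dn≡crossings ⟨
      Dn % 2           ≡⟨ even-sum⇒same-parity Dn Up even ⟩
      Up % 2           ∎
      where
      open ≡-Reasoning
      r' = r ℤ.+ 1ℤ
      Rt = rowSum a r' (mult ∘ right)
      Lf = rowSum a r' (mult ∘ left)
      Up = rowSum a r' (mult ∘ above)
      Dn = rowSum a r' (mult ∘ below)
      S = rowSum a r' (λ _ → 1)

      Dn≡crossings : Dn ≡ crossings y
      Dn≡crossings = trans (reindex above below (unshiftᶜ-shiftᶜ (suc zero)) (shiftᶜ-unshiftᶜ (suc zero)) (𝟙 ∘ RightOf? a r'))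
        (count-cong _ _ D λ {z} _ → cong (_* mult (above z)) (𝟙-cong (RightOf? a r' (above z)) (RightOf? a r z)
          (mk⇔ (λ (z₂+1≡r' , a<z₁) → ∙-cancelʳ 1ℤ _ _ z₂+1≡r' , a<z₁) (λ (z₂≡r , a<z₁) → cong (ℤ._+ 1ℤ) z₂≡r , a<z₁))))

      Lf≡Rt : Lf ≡ Rt
      Lf≡Rt = begin
        Lf                                                                ≡⟨ reindex right left (unshiftᶜ-shiftᶜ zero) (shiftᶜ-unshiftᶜ zero) (𝟙 ∘ RightOf? a r') ⟩
        count (λ z → 𝟙 (RightOf? a r' (right z)) * mult (right z)) D        ≡⟨ count-cong _ _ D (λ {z} _ → pointwise z) ⟩
        count (λ z → 𝟙 (RightOf? a r' z) * mult (right z) + 𝟙 (z ≟ᶜ ny) * mult (right ny)) D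
                                                                          ≡⟨ count-+ _ _ D ⟩
        Rt + count (λ z → 𝟙 (z ≟ᶜ ny) * mult (right ny)) D                  ≡⟨ cong (Rt +_) (count-𝟙≟* ny _) ⟩
        Rt + mult ny * mult (right ny)                                     ≡⟨ cong (λ m → Rt + m * mult (right ny)) (mult-∉ ny∉D) ⟩
        Rt + 0                                                            ≡⟨ ℕP.+-identityʳ Rt ⟩
        Rt                                                                ∎
        where
        ny = above y
        pointwise : ∀ z → 𝟙 (RightOf? a r' (right z)) * mult (right z)
                        ≡ 𝟙 (RightOf? a r' z) * mult (right z) + 𝟙 (z ≟ᶜ ny) * mult (right ny)
        pointwise z@(z₁ , z₂) = begin
          𝟙 (RightOf? a r' (right z)) * mult (right z)                            ≡⟨ cong (_* mult (right z)) split ⟩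
          (𝟙 (RightOf? a r' z) + 𝟙 (z ≟ᶜ ny)) * mult (right z)                   ≡⟨ ℕP.*-distribʳ-+ (mult (right z)) (𝟙 (RightOf? a r' z)) _ ⟩
          𝟙 (RightOf? a r' z) * mult (right z) + 𝟙 (z ≟ᶜ ny) * mult (right z)     ≡⟨ cong (𝟙 (RightOf? a r' z) * mult (right z) +_) (𝟙≟-subst {z} {ny} (mult ∘ right)) ⟩
          𝟙 (RightOf? a r' z) * mult (right z) + 𝟙 (z ≟ᶜ ny) * mult (right ny)    ∎
          where
          split : 𝟙 (RightOf? a r' (right z)) ≡ 𝟙 (RightOf? a r' z) + 𝟙 (z ≟ᶜ ny)
          split = 𝟙-⊎ (RightOf? a r' (right z)) (RightOf? a r' z) (z ≟ᶜ ny)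
            (mk⇔ (λ (z₂≡r' , a<z₁+1) → case Equivalence.to (<+1⇔<⊎≡ a z₁) a<z₁+1 of λ where
                    (inj₁ a<z₁) → inj₁ (z₂≡r' , a<z₁)
                    (inj₂ refl) → inj₂ (cong (_ ,_) z₂≡r'))
                 λ where
                   (inj₁ (z₂≡r' , a<z₁)) → z₂≡r' , Equivalence.from (<+1⇔<⊎≡ a z₁) (inj₁ a<z₁)
                   (inj₂ refl) → refl , Equivalence.from (<+1⇔<⊎≡ a z₁) (inj₂ refl))
            λ where ((_ , a<z₁) , refl) → ℤP.<-irrefl refl a<z₁

      degree-sum : rowSum a r' (λ z → count (adjacency z) D) ≡ (Rt + Lf) + (Up + Dn)
      degree-sum = begin
        rowSum a r' (λ z → count (adjacency z) D)   ≡⟨ count-cong _ _ D (λ {z} _ → cong (𝟙 (RightOf? a r' z) *_) (degree-split z)) ⟩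
        rowSum a r' (λ z → (mult (right z) + mult (left z)) + (mult (above z) + mult (below z)))
                                                    ≡⟨ rowSum-+ a r' _ _ ⟩
        rowSum a r' (λ z → mult (right z) + mult (left z))
          + rowSum a r' (λ z → mult (above z) + mult (below z))
                                                    ≡⟨ cong₂ _+_ (rowSum-+ a r' _ _) (rowSum-+ a r' _ _) ⟩
        (Rt + Lf) + (Up + Dn)                       ∎
        where
        degree-split : ∀ z → count (adjacency z) D ≡ (mult (right z) + mult (left z))
                                                     + (mult (above z) + mult (below z))
        degree-split z = trans (degree≡ z) (regroup (mult (right z)) (mult (left z)) (mult (above z)) (mult (below z)))
          where
          regroup : ∀ p q u v → p + (q + (u + (v + 0))) ≡ (p + q) + (u + v)
          regroup = ℕ-solve-∀

      degree-sum-even : rowSum a r' (λ z → count (adjacency z) D) ≡ S + S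
      degree-sum-even = trans (count-cong _ _ D λ {z} z∈D → cong (𝟙 (RightOf? a r' z) *_) (degree-2 z∈D))
                              (rowSum-+ a r' (λ _ → 1) (λ _ → 1))

      even : Even (Dn + Up)
      even = begin
        (Dn + Up) % 2                ≡⟨ +-double-parity (Dn + Up) Rt ⟨
        (Dn + Up + (Rt + Rt)) % 2    ≡⟨ cong (_% 2) (rearrange Dn Up Rt Lf (sym Lf≡Rt)) ⟩
        ((Rt + Lf) + (Up + Dn)) % 2  ≡⟨ cong (_% 2) (trans (sym degree-sum) degree-sum-even) ⟩
        (S + S) % 2                  ≡⟨ double-even S ⟩
        0                            ∎
        where
        rearrange : ∀ d u r l → r ≡ l → d + u + (r + r) ≡ (r + l) + (u + d)
        rearrange d u r _ refl = solve-+ d u r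
          where
          solve-+ : ∀ d u r → d + u + (r + r) ≡ (r + r) + (u + d)
          solve-+ = ℕ-solve-∀

    walk-parity : ∀ {u v} → Star (λ u v → u ∉ D × v ∉ D × Adj4 u v) u v → crossings u % 2 ≡ crossings v % 2
    walk-parity ε = refl
    walk-parity ((u∉D , w∉D , adj) ◅ walk) = trans (step u∉D w∉D adj) (walk-parity walk)
      where
      step : ∀ {u w} → u ∉ D → w ∉ D → Adj4 u w → crossings u % 2 ≡ crossings w % 2
      step {u} {w} u∉D w∉D adj with Adj4⇒shiftᶜ {u} {w} adj
      ... | zero , inj₁ refl = cong (_% 2) (horizontal-step u w∉D)
      ... | zero , inj₂ refl = sym (cong (_% 2) (horizontal-step w u∉D))
      ... | suc zero , inj₁ refl = vertical-step u w∉D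
      ... | suc zero , inj₂ refl = sym (vertical-step w u∉D)

-- Two-regular disks

private
  diagonal-unshiftᶜ : ∀ j x → diagonal (unshiftᶜ j x) ℤ.< diagonal x
  diagonal-unshiftᶜ j x = ℤP.suc[i]≤j⇒i<j (ℤP.≤-reflexive (lemma j x))
    where
    lemma : ∀ j x → ℤ.suc (diagonal (unshiftᶜ j x)) ≡ diagonal x
    lemma zero (a , b) = west a b
      where
      west : ∀ a b → 1ℤ ℤ.+ (a ℤ.- 1ℤ ℤ.+ b) ≡ a ℤ.+ b
      west = solve-∀
    lemma (suc zero) (a , b) = south a b
      where
      south : ∀ a b → 1ℤ ℤ.+ (a ℤ.+ (b ℤ.- 1ℤ)) ≡ a ℤ.+ b
      south = solve-∀

  both-one : ∀ m n → m ≤ 1 → n ≤ 1 → m + n ≡ 2 → 0 < m × 0 < n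
  both-one 1 1 _ _ _ = s≤s z≤n , s≤s z≤n
  both-one 0 (suc (suc _)) _ (s≤s ()) _
  both-one (suc (suc _)) _ (s≤s ()) _ _
  both-one 1 0 _ _ ()

  module MinimalCell {D : List Cell} (uniq : Unique D) (degree-2 : ∀ {y} → y ∈ D → count (adjacency y) D ≡ 2)
                     {x} (x∈D : x ∈ D) (minimal : ∀ {y} → y ∈ D → diagonal x ℤ.≤ diagonal y) where
    open Crossings D

    unshiftᶜ∉ : ∀ j → unshiftᶜ j x ∉ D
    unshiftᶜ∉ j y∈D = ℤP.<-irrefl refl (ℤP.<-≤-trans (diagonal-unshiftᶜ j x) (minimal y∈D))

    mult≤1 : ∀ w → mult w ≤ 1
    mult≤1 w with w ∈? D
    ... | yes w∈D = ℕP.≤-reflexive (mult-∈ uniq w∈D)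
    ... | no w∉D = subst (_≤ 1) (sym (mult-∉ w∉D)) z≤n

    right+above≡2 : mult (right x) + mult (above x) ≡ 2
    right+above≡2 = begin
      mult (right x) + mult (above x)                      ≡⟨ cong (mult (right x) +_) (ℕP.+-identityʳ (mult (above x))) ⟨
      mult (right x) + (0 + (mult (above x) + (0 + 0)))   ≡⟨ cong₂ (λ m m' → mult (right x) + (m + (mult (above x) + (m' + 0))))
                                                                  (mult-∉ (unshiftᶜ∉ zero)) (mult-∉ (unshiftᶜ∉ (suc zero))) ⟨
      count mult (neighbourhood x)                        ≡⟨ degree≡ x ⟨
      count (adjacency x) D                               ≡⟨ degree-2 x∈D ⟩
      2                                                   ∎
      where open ≡-Reasoning

    right∈ : right x ∈ D
    right∈ = mult>0⇒∈ (proj₁ (both-one _ _ (mult≤1 (right x)) (mult≤1 (above x)) right+above≡2))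

    above∈ : above x ∈ D
    above∈ = mult>0⇒∈ (proj₂ (both-one _ _ (mult≤1 (right x)) (mult≤1 (above x)) right+above≡2))

    module _ (conn : Connected4 (_∈ D)) (ne∈D : above (right x) ∈ D) where
      open Square (proj₁ x) (proj₂ x)

      sq∈ : ∀ i j → sq i j ∈ D
      sq∈ false false = x∈D
      sq∈ true false = right∈
      sq∈ false true = above∈
      sq∈ true true = ne∈D

      step : ∀ i j {v} → v ∈ D → Adj4 (sq i j) v → ∃[ i' ] ∃[ j' ] v ≡ sq i' j'
      step i j {v} v∈D adj with v ≟ᶜ sq (not i) j | v ≟ᶜ sq i (not j)
      ... | yes refl | _ = not i , j , refl
      ... | no _ | yes refl = i , not j , refl
      ... | no v≢n₁ | no v≢n₂ = ⊥-elim (ℕP.<-irrefl refl (ℕP.<-≤-trans (ℕP.n<1+n 2)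
              (subst (3 ≤_) (degree-2 (sq∈ i j)) (length≤degree {D} {sq i j} ((v≢n₁ ∷ v≢n₂ ∷ []) ∷ (sq≢ᵢⱼ i j ∷ []) ∷ [] ∷ []) λ where
                (here refl) → v∈D , adj
                (there (here refl)) → sq∈ (not i) j , sq-Adj4ᵢ i j
                (there (there (here refl))) → sq∈ i (not j) , sq-Adj4ⱼ i j))))

      reach : ∀ {u v} → ∃[ i ] ∃[ j ] u ≡ sq i j → Star (λ u v → u ∈ D × v ∈ D × Adj4 u v) u v →
              ∃[ i ] ∃[ j ] v ≡ sq i j
      reach at-u ε = at-u
      reach (i , j , refl) ((_ , w∈D , adj) ◅ walk) = reach (step i j w∈D adj) walk

      corner : ∀ {y} → y ∈ D → ∃[ i ] ∃[ j ] y ≡ sq i j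
      corner y∈D = reach (false , false , refl) (conn x _ x∈D y∈D)

    not-square : Connected4 (_∉ D) → above (right x) ∉ D → ⊥
    not-square conn∁ ne∉D = suc-parity (crossings x) (begin
      suc (crossings x) % 2               ≡⟨ cong (_% 2) west-crossings ⟨
      crossings (left x) % 2     ≡⟨ walk-parity degree-2 (conn∁ _ _ (unshiftᶜ∉ zero) ne∉D) ⟩
      crossings (above (right x)) % 2      ≡⟨ vertical-step degree-2 (right x) ne∉D ⟨
      crossings (right x) % 2              ≡⟨ cong (_% 2) x-crossings ⟨
      crossings x % 2                     ∎)
      where
      open ≡-Reasoning
      west-crossings : crossings (left x) ≡ suc (crossings x)
      west-crossings = begin
        crossings (left x)                                            ≡⟨ crossings-right (left x) ⟩
        crossings (right (left x))
          + mult (right (left x)) * mult (above (right (left x)))  ≡⟨ cong (λ w → crossings w + mult w * mult (above w)) (shiftᶜ-unshiftᶜ zero x) ⟩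
        crossings x + mult x * mult (above x)                                  ≡⟨ cong₂ (λ m m' → crossings x + m * m') (mult-∈ uniq x∈D) (mult-∈ uniq above∈) ⟩
        crossings x + 1                                                        ≡⟨ ℕP.+-comm (crossings x) 1 ⟩
        suc (crossings x)                                                      ∎
      x-crossings : crossings x ≡ crossings (right x)
      x-crossings = begin
        crossings x                                                  ≡⟨ crossings-right x ⟩
        crossings (right x) + mult (right x) * mult (above (right x))   ≡⟨ cong (λ m → crossings (right x) + mult (right x) * m) (mult-∉ ne∉D) ⟩
        crossings (right x) + mult (right x) * 0                       ≡⟨ cong (crossings (right x) +_) (ℕP.*-zeroʳ (mult (right x))) ⟩
        crossings (right x) + 0                                       ≡⟨ ℕP.+-identityʳ _ ⟩
        crossings (right x)                                           ∎

two-regular⇒square : ∀ {D} → IsDisk D → (∀ {y} → y ∈ D → count (adjacency y) D ≡ 2) →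
                     ∃[ a ] ∃[ b ] Square.IsSquare a b D
two-regular⇒square {[]} (_ , D≢[] , _) _ = ⊥-elim (D≢[] refl)
two-regular⇒square {D@(d ∷ ds)} (uniq , _ , conn , conn∁) degree-2 = by-corner (above (right x) ∈? D)
  where
  x = argmin diagonal d ds
  x∈D : x ∈ D
  x∈D = argmin-all diagonal {P = _∈ D} (here refl) (All.tabulate there)
  minimal : ∀ {y} → y ∈ D → diagonal x ℤ.≤ diagonal y
  minimal (here refl) = f[argmin]≤f[⊤] {f = diagonal} d ds
  minimal (there y∈ds) = All.lookup (f[argmin]≤f[xs] {f = diagonal} d ds) y∈ds
  open MinimalCell uniq degree-2 x∈D minimal
  by-corner : Dec (above (right x) ∈ D) → ∃[ a ] ∃[ b ] Square.IsSquare a b D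
  by-corner (yes ne∈D) = proj₁ x , proj₂ x , corner conn ne∈D , sq∈ conn ne∈D
  by-corner (no ne∉D) = ⊥-elim (not-square conn∁ ne∉D)

lemma3p1 : (D : List Cell) → IsDisk D → Balanced D → Trivial D →
           (N : ℕ) → 1 ≤ N →
           (t₀ t₁ : List Domino) →
           IsTiling (Prism D N) t₀ → IsTiling (Prism D N) t₁ →
           t₀ ≈ t₁
lemma3p1 D disk@(uniq , _ , conn , _) bal triv N _ t₀ t₁ T₀ T₁
  with any? (λ x → count (adjacency x) D ℕP.≤? 1) D
... | yes has-leaf with find has-leaf
...   | x , x∈D , leaf = PathPrism.flip-connected P N (path-even uniq bal P) T₀ T₁
  where
  P = path-from-leaf uniq conn (trivial⇒degree≤2 bal triv) x∈D leaf
lemma3p1 D disk@(uniq , _ , conn , _) bal triv N _ t₀ t₁ T₀ T₁ | no no-leaf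
  with two-regular⇒square disk (λ y∈D →
         ℕP.≤-antisym (trivial⇒degree≤2 bal triv y∈D) (ℕP.≰⇒> λ deg≤1 → no-leaf (lose y∈D deg≤1)))
... | a , b , square = Square.SquareTiling.flip-connected a b N square T₀ T₁
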